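{- Let $P\colon\mathcal{C}^{op}\to\mathbf{DLat}$ be a $\{\land,\lor\}$-doctrine with existential completion $P^\exists$ as described in the context, and let $Q$ be a $\{\exists,\land,\lor\}$-doctrine. There is an isomorphism of categories $\mathbf{Doc}_{\{\land,\lor\}}(P,Q)\cong\mathbf{Doc}_{\{\exists,\land,\lor\}}(P^\exists,Q)$, natural in $P$ and $Q$.
   Context: A $\{\land,\lor\}$-doctrine is a functor $P\colon\mathcal{C}^{op}\to\mathbf{DLat}$ ($\mathcal{C}$ with finite products, $\mathbf{DLat}$ distributive lattices and lattice homomorphisms); $f^\ast=P(f)$; $\pi_d\colon d\times c\to c$ is the projection forgetting $d$. It is a $\{\exists,\land,\lor\}$-doctrine if each $\pi_d^\ast$ has a left adjoint $\Sigma_d$ satisfying Frobenius ($x\land\Sigma_d y=\Sigma_d(\pi_d^\ast x\land y)$) and Beck–Chevalley ($f^\ast\Sigma_d=\Sigma_d(1_d\times f)^\ast$). Morphisms $(F,\alpha)\colon P\to Q$ of $\{\land,\lor\}$-doctrines: $F$ finite-product-preserving functor between base categories, $\alpha\colon P\Rightarrow Q\circ F^{op}$ natural with lattice-homomorphism components; morphisms of $\{\exists,\land,\lor\}$-doctrines additionally satisfy $\alpha_c\Sigma_d=\Sigma_{Fd}\alpha_{d\times c}$. Arrows in the hom-categories $\mathbf{Doc}(P,Q)$ from $(F,\alpha)$ to $(G,\beta)$ are natural transformations $\omega\colon F\Rightarrow G$ with $\alpha_c(x)\le\omega_c^\ast\beta_c(x)$ for all $c$, $x$. $P^\exists(c)$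 is the posetal reflection of the preorder of finite sets $\{(d_1,x_1),\dots,(d_n,x_n)\}$ ($d_i\in\mathcal{C}$, $x_i\in P(d_i\times c)$) with $\{(d_i,x_i)\}_{i\le n}\le\{(e_j,y_j)\}_{j\le m}$ iff for each $i$ there are arrows $r_\ell\colon d_i\times c\to e_{j_\ell}\times c$ ($\ell=1,\dots,k$, $j_\ell\le m$) with $\pi_{e_{j_\ell}}\circ r_\ell=\pi_{d_i}$ and $x_i\le r_1^\ast y_{j_1}\lor\dots\lor r_k^\ast y_{j_k}$; $P^\exists(f)$ sends $\{(d_i,x_i)\}$ to $\{(d_i,(1_{d_i}\times f)^\ast x_i)\}$; $\Sigma_d$ sends $\{(e_i,x_i)\}\in P^\exists(d\times c)$ to $\{(e_i\times d,x_i)\}\in P^\exists(c)$. $P^\exists$ is a $\{\exists,\land,\lor\}$-doctrine. -}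

module Defs where

open import Level using (Level; _⊔_) renaming (suc to lsuc)
open import Data.Product using (Σ; Σ-syntax; _,_; proj₁; proj₂) renaming (_×_ to _×ₜ_)
open import Data.List using (List; []; _∷_; _++_; map; foldr; concatMap)
open import Data.List.Membership.Propositional using (_∈_)
open import Data.List.Relation.Unary.All using (All)
open import Relation.Binary.PropositionalEquality using (_≡_; refl; sym)
open import Relation.Binary.Structures using (IsEquivalence)
open import Relation.Binary.Bundles using (Setoid)
import Relation.Binary.Reasoning.Setoid as SetoidR

record Category (a : Level) : Set (lsuc a) where
  infix  4 _≈_
  infixr 9 _∘_
  field
    Obj : Set a
    Hom : Obj → Obj → Set a
    _≈_ : ∀ {A B} → Hom A B → Hom A B → Set a
    id  : ∀ {A} → Hom A A
    _∘_ : ∀ {A B C} → Hom B C → Hom A B → Hom A C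
    ≈-equiv   : ∀ {A B} → IsEquivalence (_≈_ {A} {B})
    ∘-resp-≈  : ∀ {A B C} {f g : Hom B C} {h i : Hom A B} → f ≈ g → h ≈ i → f ∘ h ≈ g ∘ i
    identityˡ : ∀ {A B} {f : Hom A B} → id ∘ f ≈ f
    identityʳ : ∀ {A B} {f : Hom A B} → f ∘ id ≈ f
    assoc     : ∀ {A B C D} {f : Hom A B} {g : Hom B C} {h : Hom C D} →
                (h ∘ g) ∘ f ≈ h ∘ (g ∘ f)

  module ≈ {A B : Obj} = IsEquivalence (≈-equiv {A} {B})

  homSetoid : ∀ {A B : Obj} → Setoid a a
  homSetoid {A} {B} = record { Carrier = Hom A B ; _≈_ = _≈_ ; isEquivalence = ≈-equiv }

  module HomReasoning {A B : Obj} = SetoidR (homSetoid {A} {B})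

  eqHom : ∀ {A B} → A ≡ B → Hom A B
  eqHom refl = id

record Functor {a : Level} (A B : Category a) : Set a where
  private
    module A = Category A
    module B = Category B
  field
    F₀ : A.Obj → B.Obj
    F₁ : ∀ {X Y} → A.Hom X Y → B.Hom (F₀ X) (F₀ Y)
    identity     : ∀ {X} → F₁ (A.id {X}) B.≈ B.id
    homomorphism : ∀ {X Y Z} {f : A.Hom X Y} {g : A.Hom Y Z} → F₁ (g A.∘ f) B.≈ F₁ g B.∘ F₁ f
    F-resp-≈     : ∀ {X Y} {f g : A.Hom X Y} → f A.≈ g → F₁ f B.≈ F₁ g

idF : ∀ {a} {A : Category a} → Functor A A
idF {A = A} = record
  { F₀ = λ X → X ; F₁ = λ f → f
  ; identity = ≈.refl ; homomorphism = ≈.refl ; F-resp-≈ = λ p → p }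
  where open Category A

infixr 9 _∘F_
_∘F_ : ∀ {a} {A B C : Category a} → Functor B C → Functor A B → Functor A C
_∘F_ {C = C} G F = record
  { F₀ = λ X → G.F₀ (F.F₀ X)
  ; F₁ = λ f → G.F₁ (F.F₁ f)
  ; identity = ≈.trans (G.F-resp-≈ F.identity) G.identity
  ; homomorphism = ≈.trans (G.F-resp-≈ F.homomorphism) G.homomorphism
  ; F-resp-≈ = λ p → G.F-resp-≈ (F.F-resp-≈ p) }
  where
    module G = Functor G
    module F = Functor F
    open Category C

record FiniteProducts {a : Level} (C : Category a) : Set a where
  open Category C
  infixr 7 _×_
  field
    𝟙 : Obj
    ! : ∀ {A} → Hom A 𝟙
    !-unique : ∀ {A} (f : Hom A 𝟙) → f ≈ !
    _×_ : Obj → Obj → Obj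
    π₁ : ∀ {A B} → Hom (A × B) A
    π₂ : ∀ {A B} → Hom (A × B) B
    ⟨_,_⟩ : ∀ {X A B} → Hom X A → Hom X B → Hom X (A × B)
    project₁ : ∀ {X A B} {f : Hom X A} {g : Hom X B} → π₁ ∘ ⟨ f , g ⟩ ≈ f
    project₂ : ∀ {X A B} {f : Hom X A} {g : Hom X B} → π₂ ∘ ⟨ f , g ⟩ ≈ g
    unique   : ∀ {X A B} {h : Hom X (A × B)} {f : Hom X A} {g : Hom X B} →
               π₁ ∘ h ≈ f → π₂ ∘ h ≈ g → ⟨ f , g ⟩ ≈ h

  id×_ : ∀ {d c c'} → Hom c' c → Hom (d × c') (d × c)
  id× f = ⟨ π₁ , f ∘ π₂ ⟩

  assocʳ : ∀ {e d c} → Hom ((e × d) × c) (e × (d × c))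
  assocʳ = ⟨ π₁ ∘ π₁ , ⟨ π₂ ∘ π₁ , π₂ ⟩ ⟩

record CartCat (a : Level) : Set (lsuc a) where
  field
    cat  : Category a
    prod : FiniteProducts cat
  open Category cat public
  open FiniteProducts prod public

-- finite-product-preserving functors (with chosen inverses of the comparison maps)
record FPFunctor {a : Level} (C D : CartCat a) : Set a where
  private
    module C = CartCat C
    module D = CartCat D
  field
    functor : Functor C.cat D.cat
  open Functor functor public
  field
    𝟙-inv   : D.Hom D.𝟙 (F₀ C.𝟙)
    𝟙-inv-l : 𝟙-inv D.∘ D.! D.≈ D.id
    𝟙-inv-r : D.! D.∘ 𝟙-inv D.≈ D.id
    φ   : ∀ d c → D.Hom (F₀ d D.× F₀ c) (F₀ (d C.× c))
    φ-l : ∀ d c → φ d c D.∘ D.⟨ F₁ C.π₁ , F₁ C.π₂ ⟩ D.≈ D.id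
    φ-r : ∀ d c → D.⟨ F₁ C.π₁ , F₁ C.π₂ ⟩ D.∘ φ d c D.≈ D.id

compFP : ∀ {a} {C D E : CartCat a} → FPFunctor C D → FPFunctor D E → FPFunctor C E
compFP {C = C} {D} {E} F G = record
  { functor = G.functor ∘F F.functor
  ; 𝟙-inv = G.F₁ F.𝟙-inv E.∘ G.𝟙-inv
  ; 𝟙-inv-l = inv-l
  ; 𝟙-inv-r = E.≈.trans (E.!-unique _) (E.≈.sym (E.!-unique E.id))
  ; φ = λ d c → G.F₁ (F.φ d c) E.∘ G.φ (F.F₀ d) (F.F₀ c)
  ; φ-l = φl
  ; φ-r = φr
  }
  where
    module C = CartCat C
    module D = CartCat D
    module E = CartCat E
    module F = FPFunctor F
    module G = FPFunctor G
    open E.HomReasoning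

    into-G𝟙 : ∀ {X} (h k : E.Hom X (G.F₀ D.𝟙)) → h E.≈ k
    into-G𝟙 h k = begin
      h                           ≈⟨ E.≈.sym E.identityˡ ⟩
      E.id E.∘ h                  ≈⟨ E.∘-resp-≈ (E.≈.sym G.𝟙-inv-l) E.≈.refl ⟩
      (G.𝟙-inv E.∘ E.!) E.∘ h     ≈⟨ E.assoc ⟩
      G.𝟙-inv E.∘ (E.! E.∘ h)     ≈⟨ E.∘-resp-≈ E.≈.refl (E.≈.trans (E.!-unique _) (E.≈.sym (E.!-unique _))) ⟩
      G.𝟙-inv E.∘ (E.! E.∘ k)     ≈⟨ E.≈.sym E.assoc ⟩
      (G.𝟙-inv E.∘ E.!) E.∘ k     ≈⟨ E.∘-resp-≈ G.𝟙-inv-l E.≈.refl ⟩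
      E.id E.∘ k                  ≈⟨ E.identityˡ ⟩
      k                           ∎

    inv-l : (G.F₁ F.𝟙-inv E.∘ G.𝟙-inv) E.∘ E.! E.≈ E.id
    inv-l = begin
      (G.F₁ F.𝟙-inv E.∘ G.𝟙-inv) E.∘ E.!  ≈⟨ E.assoc ⟩
      G.F₁ F.𝟙-inv E.∘ (G.𝟙-inv E.∘ E.!)  ≈⟨ E.∘-resp-≈ E.≈.refl (into-G𝟙 _ (G.F₁ D.!)) ⟩
      G.F₁ F.𝟙-inv E.∘ G.F₁ D.!            ≈⟨ E.≈.sym G.homomorphism ⟩
      G.F₁ (F.𝟙-inv D.∘ D.!)               ≈⟨ G.F-resp-≈ F.𝟙-inv-l ⟩
      G.F₁ D.id                            ≈⟨ G.identity ⟩
      E.id                                 ∎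

    ψF : ∀ d c → D.Hom (F.F₀ (d C.× c)) (F.F₀ d D.× F.F₀ c)
    ψF d c = D.⟨ F.F₁ C.π₁ , F.F₁ C.π₂ ⟩
    ψG : ∀ d c → E.Hom (G.F₀ (d D.× c)) (G.F₀ d E.× G.F₀ c)
    ψG d c = E.⟨ G.F₁ D.π₁ , G.F₁ D.π₂ ⟩

    ψ-split : ∀ d c → E.⟨ G.F₁ (F.F₁ (C.π₁ {d} {c})) , G.F₁ (F.F₁ C.π₂) ⟩
                        E.≈ ψG (F.F₀ d) (F.F₀ c) E.∘ G.F₁ (ψF d c)
    ψ-split d c = E.unique
      (begin
        E.π₁ E.∘ (ψG _ _ E.∘ G.F₁ (ψF d c))   ≈⟨ E.≈.sym E.assoc ⟩
        (E.π₁ E.∘ ψG _ _) E.∘ G.F₁ (ψF d c)   ≈⟨ E.∘-resp-≈ E.project₁ E.≈.refl ⟩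
        G.F₁ D.π₁ E.∘ G.F₁ (ψF d c)           ≈⟨ E.≈.sym G.homomorphism ⟩
        G.F₁ (D.π₁ D.∘ ψF d c)                ≈⟨ G.F-resp-≈ D.project₁ ⟩
        G.F₁ (F.F₁ C.π₁)                      ∎)
      (begin
        E.π₂ E.∘ (ψG _ _ E.∘ G.F₁ (ψF d c))   ≈⟨ E.≈.sym E.assoc ⟩
        (E.π₂ E.∘ ψG _ _) E.∘ G.F₁ (ψF d c)   ≈⟨ E.∘-resp-≈ E.project₂ E.≈.refl ⟩
        G.F₁ D.π₂ E.∘ G.F₁ (ψF d c)           ≈⟨ E.≈.sym G.homomorphism ⟩
        G.F₁ (D.π₂ D.∘ ψF d c)                ≈⟨ G.F-resp-≈ D.project₂ ⟩
        G.F₁ (F.F₁ C.π₂)                      ∎)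

    φl : ∀ d c → (G.F₁ (F.φ d c) E.∘ G.φ (F.F₀ d) (F.F₀ c)) E.∘
                   E.⟨ G.F₁ (F.F₁ C.π₁) , G.F₁ (F.F₁ C.π₂) ⟩ E.≈ E.id
    φl d c = begin
      (G.F₁ (F.φ d c) E.∘ G.φ _ _) E.∘ E.⟨ _ , _ ⟩
          ≈⟨ E.∘-resp-≈ E.≈.refl (ψ-split d c) ⟩
      (G.F₁ (F.φ d c) E.∘ G.φ _ _) E.∘ (ψG _ _ E.∘ G.F₁ (ψF d c))
          ≈⟨ E.assoc ⟩
      G.F₁ (F.φ d c) E.∘ (G.φ _ _ E.∘ (ψG _ _ E.∘ G.F₁ (ψF d c)))
          ≈⟨ E.∘-resp-≈ E.≈.refl (E.≈.sym E.assoc) ⟩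
      G.F₁ (F.φ d c) E.∘ ((G.φ _ _ E.∘ ψG _ _) E.∘ G.F₁ (ψF d c))
          ≈⟨ E.∘-resp-≈ E.≈.refl (E.∘-resp-≈ (G.φ-l _ _) E.≈.refl) ⟩
      G.F₁ (F.φ d c) E.∘ (E.id E.∘ G.F₁ (ψF d c))
          ≈⟨ E.∘-resp-≈ E.≈.refl E.identityˡ ⟩
      G.F₁ (F.φ d c) E.∘ G.F₁ (ψF d c)
          ≈⟨ E.≈.sym G.homomorphism ⟩
      G.F₁ (F.φ d c D.∘ ψF d c)
          ≈⟨ G.F-resp-≈ (F.φ-l d c) ⟩
      G.F₁ D.id
          ≈⟨ G.identity ⟩
      E.id ∎

    φr : ∀ d c → E.⟨ G.F₁ (F.F₁ C.π₁) , G.F₁ (F.F₁ C.π₂) ⟩ E.∘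
                   (G.F₁ (F.φ d c) E.∘ G.φ (F.F₀ d) (F.F₀ c)) E.≈ E.id
    φr d c = begin
      E.⟨ _ , _ ⟩ E.∘ (G.F₁ (F.φ d c) E.∘ G.φ _ _)
          ≈⟨ E.∘-resp-≈ (ψ-split d c) E.≈.refl ⟩
      (ψG _ _ E.∘ G.F₁ (ψF d c)) E.∘ (G.F₁ (F.φ d c) E.∘ G.φ _ _)
          ≈⟨ E.assoc ⟩
      ψG _ _ E.∘ (G.F₁ (ψF d c) E.∘ (G.F₁ (F.φ d c) E.∘ G.φ _ _))
          ≈⟨ E.∘-resp-≈ E.≈.refl (E.≈.sym E.assoc) ⟩
      ψG _ _ E.∘ ((G.F₁ (ψF d c) E.∘ G.F₁ (F.φ d c)) E.∘ G.φ _ _)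
          ≈⟨ E.∘-resp-≈ E.≈.refl (E.∘-resp-≈ (E.≈.sym G.homomorphism) E.≈.refl) ⟩
      ψG _ _ E.∘ (G.F₁ (ψF d c D.∘ F.φ d c) E.∘ G.φ _ _)
          ≈⟨ E.∘-resp-≈ E.≈.refl (E.∘-resp-≈ (E.≈.trans (G.F-resp-≈ (F.φ-r d c)) G.identity) E.≈.refl) ⟩
      ψG _ _ E.∘ (E.id E.∘ G.φ _ _)
          ≈⟨ E.∘-resp-≈ E.≈.refl E.identityˡ ⟩
      ψG _ _ E.∘ G.φ _ _
          ≈⟨ G.φ-r _ _ ⟩
      E.id ∎

-- Bounded distributive lattices, presented as a carrier with a preorder
-- (the lattice is its posetal reflection; equality is  x ≤ y and y ≤ x)

record RawDLat (a : Level) : Set (lsuc a) where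
  infix  4 _≤_ _≃_
  infixr 6 _∧_
  infixr 5 _∨_
  field
    Carrier : Set a
    _≤_ : Carrier → Carrier → Set a
    ⊤ ⊥ : Carrier
    _∧_ _∨_ : Carrier → Carrier → Carrier

  _≃_ : Carrier → Carrier → Set a
  x ≃ y = x ≤ y ×ₜ y ≤ x

  ⋁ : List Carrier → Carrier
  ⋁ = foldr _∨_ ⊥

record IsDLat {a : Level} (L : RawDLat a) : Set a where
  open RawDLat L
  field
    refl≤  : ∀ {x} → x ≤ x
    trans≤ : ∀ {x y z} → x ≤ y → y ≤ z → x ≤ z
    ⊤-max  : ∀ {x} → x ≤ ⊤
    ⊥-min  : ∀ {x} → ⊥ ≤ x
    ∧-lb₁  : ∀ {x y} → x ∧ y ≤ x
    ∧-lb₂  : ∀ {x y} → x ∧ y ≤ y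
    ∧-glb  : ∀ {x y z} → z ≤ x → z ≤ y → z ≤ x ∧ y
    ∨-ub₁  : ∀ {x y} → x ≤ x ∨ y
    ∨-ub₂  : ∀ {x y} → y ≤ x ∨ y
    ∨-lub  : ∀ {x y z} → x ≤ z → y ≤ z → x ∨ y ≤ z
    distrib : ∀ {x y z} → x ∧ (y ∨ z) ≤ (x ∧ y) ∨ (x ∧ z)

  ≃-trans : ∀ {x y z} → x ≃ y → y ≃ z → x ≃ z
  ≃-trans (p , q) (r , s) = trans≤ p r , trans≤ s q

  ≃-sym : ∀ {x y} → x ≃ y → y ≃ x
  ≃-sym (p , q) = q , p

record IsLatHom {a : Level} (A B : RawDLat a) (h : RawDLat.Carrier A → RawDLat.Carrier B) : Set a where
  private
    module A = RawDLat A
    module B = RawDLat B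
  field
    mono  : ∀ {x y} → x A.≤ y → h x B.≤ h y
    pres-⊤ : h A.⊤ B.≃ B.⊤
    pres-⊥ : h A.⊥ B.≃ B.⊥
    pres-∧ : ∀ x y → h (x A.∧ y) B.≃ h x B.∧ h y
    pres-∨ : ∀ x y → h (x A.∨ y) B.≃ h x B.∨ h y

  cong≃ : ∀ {x y} → x A.≃ y → h x B.≃ h y
  cong≃ (p , q) = mono p , mono q

-- the data of a functor C^op → DLat (used for P^∃, whose laws are not needed here)
record RawDoctrine {a : Level} (C : CartCat a) : Set (lsuc a) where
  open CartCat C
  field
    fib : Obj → RawDLat a
    reindex : ∀ {c d} → Hom c d → RawDLat.Carrier (fib d) → RawDLat.Carrier (fib c)

record Doctrine {a : Level} (C : CartCat a) : Set (lsuc a) where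
  open CartCat C
  field
    raw : RawDoctrine C
  open RawDoctrine raw public
  private
    module L (c : Obj) = RawDLat (fib c)
  field
    isDLat       : ∀ c → IsDLat (fib c)
    reindex-hom  : ∀ {c d} (f : Hom c d) → IsLatHom (fib d) (fib c) (reindex f)
    reindex-resp : ∀ {c d} {f g : Hom c d} → f ≈ g → ∀ x → L._≃_ c (reindex f x) (reindex g x)
    reindex-id   : ∀ {c} x → L._≃_ c (reindex (id {c}) x) x
    reindex-∘    : ∀ {c d e} (f : Hom c d) (g : Hom d e) x →
                   L._≃_ c (reindex (g ∘ f) x) (reindex f (reindex g x))

record RawExDoctrine {a : Level} (C : CartCat a) : Set (lsuc a) where
  open CartCat C
  field
    rawDoc : RawDoctrine C
  open RawDoctrine rawDoc public
  field
    exists : ∀ d c → RawDLat.Carrier (fib (d × c)) → RawDLat.Carrier (fib c)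

record ExDoctrine {a : Level} (C : CartCat a) : Set (lsuc a) where
  open CartCat C
  field
    doc : Doctrine C
  open Doctrine doc public
  private
    module L (c : Obj) = RawDLat (fib c)
  field
    exists : ∀ d c → L.Carrier (d × c) → L.Carrier c
    adj-⇒ : ∀ {d c} y x → L._≤_ c (exists d c y) x → L._≤_ (d × c) y (reindex (π₂ {d} {c}) x)
    adj-⇐ : ∀ {d c} y x → L._≤_ (d × c) y (reindex (π₂ {d} {c}) x) → L._≤_ c (exists d c y) x
    frobenius : ∀ {d c} x y →
      L._≃_ c (L._∧_ c x (exists d c y)) (exists d c (L._∧_ (d × c) (reindex (π₂ {d} {c}) x) y))
    beck-chevalley : ∀ {d c c'} (f : Hom c' c) y →
      L._≃_ c' (reindex f (exists d c y)) (exists d c' (reindex (id×_ {d} f) y))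

  rawEx : RawExDoctrine C
  rawEx = record { rawDoc = raw ; exists = exists }

module _ {a : Level} {C D : CartCat a} (P : RawDoctrine C) (Q : RawDoctrine D) where
  private
    module C = CartCat C
    module D = CartCat D
    module P = RawDoctrine P
    module Q = RawDoctrine Q
    module PL (c : C.Obj) = RawDLat (P.fib c)
    module QL (c : D.Obj) = RawDLat (Q.fib c)

  record IsDocMor (F : FPFunctor C D)
                  (α : ∀ c → PL.Carrier c → QL.Carrier (FPFunctor.F₀ F c)) : Set a where
    open FPFunctor F
    field
      α-hom : ∀ c → IsLatHom (P.fib c) (Q.fib (F₀ c)) (α c)
      α-nat : ∀ {c d} (f : C.Hom c d) x →
              QL._≃_ (F₀ c) (α c (P.reindex f x)) (Q.reindex (F₁ f) (α d x))

  record DocMor : Set a where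
    field
      F : FPFunctor C D
    open FPFunctor F public
    field
      α : ∀ c → PL.Carrier c → QL.Carrier (F₀ c)
      isMor : IsDocMor F α
    open IsDocMor isMor public

module _ {a : Level} {C D : CartCat a} (P : RawExDoctrine C) (Q : RawExDoctrine D) where
  private
    module C = CartCat C
    module D = CartCat D
    module P = RawExDoctrine P
    module Q = RawExDoctrine Q
    module PL (c : C.Obj) = RawDLat (P.fib c)
    module QL (c : D.Obj) = RawDLat (Q.fib c)

  PresΣ : (F : FPFunctor C D) (α : ∀ c → PL.Carrier c → QL.Carrier (FPFunctor.F₀ F c)) → Set a
  PresΣ F α = ∀ d c y →
    QL._≃_ (F₀ c) (α c (P.exists d c y)) (Q.exists (F₀ d) (F₀ c) (Q.reindex (φ d c) (α (d C.× c) y)))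
    where open FPFunctor F

  record ExMor : Set a where
    field
      mor : DocMor P.rawDoc Q.rawDoc
    open DocMor mor public
    field
      α-Σ : PresΣ F α

module _ {a : Level} {C D : CartCat a} {P : RawDoctrine C} {Q : RawDoctrine D} where
  private
    module C = CartCat C
    module D = CartCat D
    module Q = RawDoctrine Q
    module QL (c : D.Obj) = RawDLat (Q.fib c)

  record IsCell (X Y : DocMor P Q) (ω : ∀ c → D.Hom (DocMor.F₀ X c) (DocMor.F₀ Y c)) : Set a where
    private
      module X = DocMor X
      module Y = DocMor Y
    field
      nat : ∀ {c d} (f : C.Hom c d) → Y.F₁ f D.∘ ω c D.≈ ω d D.∘ X.F₁ f
      le  : ∀ c x → QL._≤_ (X.F₀ c) (X.α c x) (Q.reindex (ω c) (Y.α c x))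

  record Cell (X Y : DocMor P Q) : Set a where
    field
      ω : ∀ c → D.Hom (DocMor.F₀ X c) (DocMor.F₀ Y c)
      isCell : IsCell X Y ω
    open IsCell isCell public

  -- equality of objects of the hom-categories: same functor (on objects up to ≡,
  -- on arrows up to ≈) and the same α (up to the lattice equality)
  _≐_ : DocMor P Q → DocMor P Q → Set a
  X ≐ Y = Σ[ e ∈ (∀ c → DocMor.F₀ X c ≡ DocMor.F₀ Y c) ]
            (IsCell X Y (λ c → D.eqHom (e c)) ×ₜ IsCell Y X (λ c → D.eqHom (sym (e c))))

-- the hom-category of doctrine morphisms (restricted along U to a class of morphisms);
-- arrows are 2-cells, compared componentwise
DocOver : ∀ {a} {C D : CartCat a} {P : RawDoctrine C} (Q : Doctrine D)
          {I : Set a} (U : I → DocMor P (Doctrine.raw Q)) → Category a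
DocOver {C = C} {D} {P} Q {I} U = record
  { Obj = I
  ; Hom = λ X Y → Cell (U X) (U Y)
  ; _≈_ = λ ω θ → ∀ c → Cell.ω ω c D.≈ Cell.ω θ c
  ; id = idCell
  ; _∘_ = compCell
  ; ≈-equiv = record
      { refl = λ c → D.≈.refl
      ; sym = λ p c → D.≈.sym (p c)
      ; trans = λ p q c → D.≈.trans (p c) (q c) }
  ; ∘-resp-≈ = λ p q c → D.∘-resp-≈ (p c) (q c)
  ; identityˡ = λ c → D.identityˡ
  ; identityʳ = λ c → D.identityʳ
  ; assoc = λ c → D.assoc
  }
  where
    module C = CartCat C
    module D = CartCat D
    module Q = Doctrine Q
    module QL (c : D.Obj) = RawDLat (Q.fib c)
    module QI (c : D.Obj) = IsDLat (Q.isDLat c)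
    open D.HomReasoning

    idCell : ∀ {X} → Cell (U X) (U X)
    idCell {X} = record
      { ω = λ c → D.id
      ; isCell = record
        { nat = λ f → D.≈.trans D.identityʳ (D.≈.sym D.identityˡ)
        ; le = λ c x → proj₂ (Q.reindex-id (DocMor.α (U X) c x)) } }

    compCell : ∀ {X Y Z} → Cell (U Y) (U Z) → Cell (U X) (U Y) → Cell (U X) (U Z)
    compCell {X} {Y} {Z} θ ω = record
      { ω = λ c → θ.ω c D.∘ ω.ω c
      ; isCell = record
        { nat = λ {c} {d} f → begin
            Z.F₁ f D.∘ (θ.ω c D.∘ ω.ω c)   ≈⟨ D.≈.sym D.assoc ⟩
            (Z.F₁ f D.∘ θ.ω c) D.∘ ω.ω c   ≈⟨ D.∘-resp-≈ (θ.nat f) D.≈.refl ⟩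
            (θ.ω d D.∘ Y.F₁ f) D.∘ ω.ω c   ≈⟨ D.assoc ⟩
            θ.ω d D.∘ (Y.F₁ f D.∘ ω.ω c)   ≈⟨ D.∘-resp-≈ D.≈.refl (ω.nat f) ⟩
            θ.ω d D.∘ (ω.ω d D.∘ X.F₁ f)   ≈⟨ D.≈.sym D.assoc ⟩
            (θ.ω d D.∘ ω.ω d) D.∘ X.F₁ f   ∎
        ; le = λ c x →
            QI.trans≤ (X.F₀ c) (ω.le c x)
              (QI.trans≤ (X.F₀ c) (IsLatHom.mono (Q.reindex-hom (ω.ω c)) (θ.le c x))
                 (proj₂ (Q.reindex-∘ (ω.ω c) (θ.ω c) (Z.α c x)))) } }
      where
        module X = DocMor (U X)
        module Y = DocMor (U Y)
        module Z = DocMor (U Z)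
        module θ = Cell θ
        module ω = Cell ω

Doc : ∀ {a} {C D : CartCat a} (P : Doctrine C) (Q : Doctrine D) → Category a
Doc P Q = DocOver Q {I = DocMor (Doctrine.raw P) (Doctrine.raw Q)} (λ X → X)

DocEx : ∀ {a} {C D : CartCat a} (E : RawExDoctrine C) (Q : ExDoctrine D) → Category a
DocEx E Q = DocOver (ExDoctrine.doc Q) {I = ExMor E (ExDoctrine.rawEx Q)} ExMor.mor

record _≡F_ {a} {A : Category a} {C D : CartCat a} {P : RawDoctrine C} {Q : Doctrine D}
            {I : Set a} {U : I → DocMor P (Doctrine.raw Q)}
            (K K' : Functor A (DocOver Q U)) : Set a where
  private
    module A = Category A
    module D = CartCat D
    module K = Functor K
    module K' = Functor K'
  field
    eq₀ : ∀ X → U (K.F₀ X) ≐ U (K'.F₀ X)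
    eq₁ : ∀ {X Y} (f : A.Hom X Y) c →
          D.eqHom (proj₁ (eq₀ Y) c) D.∘ Cell.ω (K.F₁ f) c
            D.≈ Cell.ω (K'.F₁ f) c D.∘ D.eqHom (proj₁ (eq₀ X) c)

compDoc : ∀ {a} {C D E : CartCat a} {P₁ : RawDoctrine C} {P₂ : RawDoctrine D} (Q : Doctrine E) →
          DocMor P₁ P₂ → DocMor P₂ (Doctrine.raw Q) → DocMor P₁ (Doctrine.raw Q)
compDoc {E = E} Q J K = record
  { F = compFP J.F K.F
  ; α = λ c x → K.α (J.F₀ c) (J.α c x)
  ; isMor = record
    { α-hom = λ c → record
      { mono = λ p → IsLatHom.mono (K.α-hom _) (IsLatHom.mono (J.α-hom c) p)
      ; pres-⊤ = QI.≃-trans _ (KH.cong≃ _ (JH.pres-⊤ c)) (KH.pres-⊤ _)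
      ; pres-⊥ = QI.≃-trans _ (KH.cong≃ _ (JH.pres-⊥ c)) (KH.pres-⊥ _)
      ; pres-∧ = λ x y → QI.≃-trans _ (KH.cong≃ _ (JH.pres-∧ c x y)) (KH.pres-∧ _ _ _)
      ; pres-∨ = λ x y → QI.≃-trans _ (KH.cong≃ _ (JH.pres-∨ c x y)) (KH.pres-∨ _ _ _) }
    ; α-nat = λ f x → QI.≃-trans _ (KH.cong≃ _ (J.α-nat f x)) (K.α-nat (J.F₁ f) (J.α _ x)) } }
  where
    module J = DocMor J
    module K = DocMor K
    module Q = Doctrine Q
    module QI (c : CartCat.Obj E) = IsDLat (Q.isDLat c)
    module JH c = IsLatHom (J.α-hom c)
    module KH c = IsLatHom (K.α-hom c)

compEx : ∀ {a} {C D E : CartCat a} {P₁ : RawExDoctrine C} {P₂ : RawExDoctrine D} (Q : ExDoctrine E) →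
         ExMor P₁ P₂ → ExMor P₂ (ExDoctrine.rawEx Q) → ExMor P₁ (ExDoctrine.rawEx Q)
compEx {E = E} {P₁} {P₂} Q J K = record
  { mor = compDoc (ExDoctrine.doc Q) (ExMor.mor J) (ExMor.mor K)
  ; α-Σ = λ d c y →
      QI.≃-trans _ (KH.cong≃ _ (J.α-Σ d c y))
     (QI.≃-trans _ (K.α-Σ (J.F₀ d) (J.F₀ c) _)
     (QI.≃-trans _ (Σ-cong (RH.cong≃ (K.φ (J.F₀ d) (J.F₀ c)) (K.α-nat (J.φ d c) _)))
                   (Σ-cong (QI.≃-sym _ (Q.reindex-∘ (K.φ (J.F₀ d) (J.F₀ c)) (K.F₁ (J.φ d c)) _))))) }
  where
    module J = ExMor J
    module K = ExMor K
    module E = CartCat E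
    module Q = ExDoctrine Q
    module QL (c : E.Obj) = RawDLat (Q.fib c)
    module QI (c : E.Obj) = IsDLat (Q.isDLat c)
    module KH c = IsLatHom (K.α-hom c)
    module RH {c d} (f : E.Hom c d) = IsLatHom (Q.reindex-hom f)

    Σ-mono : ∀ {d c} {y y' : QL.Carrier (d E.× c)} → QL._≤_ _ y y' → QL._≤_ c (Q.exists d c y) (Q.exists d c y')
    Σ-mono {d} {c} {y} {y'} p =
      Q.adj-⇐ y (Q.exists d c y') (QI.trans≤ _ p (Q.adj-⇒ y' (Q.exists d c y') (QI.refl≤ c)))

    Σ-cong : ∀ {d c} {y y' : QL.Carrier (d E.× c)} → QL._≃_ _ y y' → QL._≃_ c (Q.exists d c y) (Q.exists d c y')
    Σ-cong (p , q) = Σ-mono p , Σ-mono q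

module _ {a : Level} {C' C D D' : CartCat a} {P' : RawDoctrine C'} {P : RawDoctrine C}
         {Q : Doctrine D} {Q' : Doctrine D'}
         (L : DocMor P' P) (M : DocMor (Doctrine.raw Q) (Doctrine.raw Q')) where
  private
    module D' = CartCat D'
    module M = DocMor M
    module L = DocMor L
    module Q' = Doctrine Q'
    module Q'I (c : D'.Obj) = IsDLat (Q'.isDLat c)

  whisker : DocMor P (Doctrine.raw Q) → DocMor P' (Doctrine.raw Q')
  whisker X = compDoc Q' (compDoc Q L X) M

  whiskerCell : ∀ {X Y} → Cell X Y → Cell (whisker X) (whisker Y)
  whiskerCell {X} {Y} ω = record
    { ω = λ c → M.F₁ (ω.ω (L.F₀ c))
    ; isCell = record
      { nat = λ f → D'.≈.trans (D'.≈.sym M.homomorphism)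
                   (D'.≈.trans (M.F-resp-≈ (ω.nat (L.F₁ f))) M.homomorphism)
      ; le = λ c x → Q'I.trans≤ _ (IsLatHom.mono (M.α-hom _) (ω.le (L.F₀ c) (L.α c x)))
                                   (proj₁ (M.α-nat (ω.ω (L.F₀ c)) _)) } }
    where module ω = Cell ω

W : ∀ {a} {C' C D D' : CartCat a} {P' : Doctrine C'} {P : Doctrine C} {Q : Doctrine D} {Q' : Doctrine D'}
    (L : DocMor (Doctrine.raw P') (Doctrine.raw P)) (M : DocMor (Doctrine.raw Q) (Doctrine.raw Q')) →
    Functor (Doc P Q) (Doc P' Q')
W {Q = Q} {Q'} L M = record
  { F₀ = whisker {Q = Q} {Q'} L M
  ; F₁ = whiskerCell {Q = Q} {Q'} L M
  ; identity = λ c → M.identity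
  ; homomorphism = λ c → M.homomorphism
  ; F-resp-≈ = λ p c → M.F-resp-≈ (p (DocMor.F₀ L c)) }
  where module M = DocMor M

W∃ : ∀ {a} {C' C D D' : CartCat a} {E' : RawExDoctrine C'} {E : RawExDoctrine C}
     {Q : ExDoctrine D} {Q' : ExDoctrine D'}
     (L : ExMor E' E) (M : ExMor (ExDoctrine.rawEx Q) (ExDoctrine.rawEx Q')) →
     Functor (DocEx E Q) (DocEx E' Q')
W∃ {Q = Q} {Q'} L M = record
  { F₀ = λ Y → compEx Q' (compEx Q L Y) M
  ; F₁ = whiskerCell {Q = ExDoctrine.doc Q} {ExDoctrine.doc Q'} (ExMor.mor L) (ExMor.mor M)
  ; identity = λ c → M.identity
  ; homomorphism = λ c → M.homomorphism
  ; F-resp-≈ = λ p c → M.F-resp-≈ (p (ExMor.F₀ L c)) }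
  where module M = ExMor M

module _ {a : Level} {C : CartCat a} (P : RawDoctrine C) where
  private
    module C = CartCat C
    module P = RawDoctrine P
    module PL (c : C.Obj) = RawDLat (P.fib c)
  open C using (Obj; Hom; _×_; _∘_; _≈_; π₁; π₂; ⟨_,_⟩; 𝟙)

  Elem : Obj → Set a
  Elem c = Σ[ d ∈ Obj ] PL.Carrier (d × c)

  record Witness (c d : Obj) (ys : List (Elem c)) : Set a where
    field
      tgt  : Elem c
      mem  : tgt ∈ ys
      arr  : Hom (d × c) (proj₁ tgt × c)
      comm : π₂ ∘ arr ≈ π₂

  Covered : ∀ c → Elem c → List (Elem c) → Set a
  Covered c (d , x) ys =
    Σ[ ws ∈ List (Witness c d ys) ]
      PL._≤_ (d × c) x (PL.⋁ (d × c) (map (λ w → P.reindex (Witness.arr w) (proj₂ (Witness.tgt w))) ws))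

  _≤∃_ : ∀ {c} → List (Elem c) → List (Elem c) → Set a
  _≤∃_ {c} xs ys = All (λ e → Covered c e ys) xs

  meetElem : ∀ {c} → Elem c → Elem c → Elem c
  meetElem (d , x) (e , y) =
    (d × e) , PL._∧_ _ (P.reindex ⟨ π₁ ∘ π₁ , π₂ ⟩ x) (P.reindex ⟨ π₂ ∘ π₁ , π₂ ⟩ y)

  ExFib : Obj → RawDLat a
  ExFib c = record
    { Carrier = List (Elem c)
    ; _≤_ = _≤∃_
    ; ⊤ = (𝟙 , PL.⊤ (𝟙 × c)) ∷ []
    ; ⊥ = []
    ; _∧_ = λ xs ys → concatMap (λ u → map (meetElem u) ys) xs
    ; _∨_ = _++_ }

  ExComp : RawExDoctrine C
  ExComp = record
    { rawDoc = record
      { fib = ExFib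
      ; reindex = λ {c'} {c} f → map (λ u → proj₁ u , P.reindex (C.id×_ {proj₁ u} f) (proj₂ u)) }
    ; exists = λ d c → map (λ u → (proj₁ u × d) , P.reindex (C.assocʳ {proj₁ u} {d} {c}) (proj₂ u)) }

module _ {a : Level} {C' C : CartCat a} {P' : RawDoctrine C'} {P : RawDoctrine C}
         (L : DocMor P' P) where
  private
    module C' = CartCat C'
    module L = DocMor L
    module P = RawDoctrine P

  extMap : ∀ c → List (Elem P' c) → List (Elem P (L.F₀ c))
  extMap c = map (λ u → L.F₀ (proj₁ u) , P.reindex (L.φ (proj₁ u) c) (L.α (proj₁ u C'.× c) (proj₂ u)))

  ExtLaws : Set a
  ExtLaws = IsDocMor (RawExDoctrine.rawDoc (ExComp P')) (RawExDoctrine.rawDoc (ExComp P)) L.F extMap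
            ×ₜ PresΣ (ExComp P') (ExComp P) L.F extMap

  extMor : ExtLaws → ExMor (ExComp P') (ExComp P)
  extMor laws = record
    { mor = record { F = L.F ; α = extMap ; isMor = proj₁ laws }
    ; α-Σ = proj₂ laws }

FunctorEqDoc : ∀ {a} {A : Category a} {C D : CartCat a} (P : Doctrine C) (Q : Doctrine D)
               (K K' : Functor A (Doc P Q)) → Set a
FunctorEqDoc P Q K K' = _≡F_ {Q = Q} {U = λ X → X} K K'

FunctorEqEx : ∀ {a} {A : Category a} {C D : CartCat a} (E : RawExDoctrine C) (Q : ExDoctrine D)
              (K K' : Functor A (DocEx E Q)) → Set a
FunctorEqEx E Q K K' = _≡F_ {Q = ExDoctrine.doc Q} {U = ExMor.mor} K K'

{-# OPTIONS --safe #-}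
-- A morphism X = (F, α) : P → Q into a {∃,∧,∨}-doctrine extends to P^∃ as the composite ε_Q ∘ X^∃.
-- Here X^∃ applies X to every pair, {(d_i, x_i)} ↦ {(F d_i, φ^* α x_i)}, and the counit
-- ε_Q : Q^∃ → Q, {(e_j, y_j)} ↦ ⋁_j Σ_{e_j} y_j, preserves meets by Frobenius, reindexing by
-- Beck–Chevalley and Σ because Σ_d Σ_e = Σ_{e×d}. Conversely a morphism out of P^∃ restricts along
-- the unit x ↦ {(1, π^* x)}. The two constructions are mutually inverse because every generator
-- {(d, x)} of P^∃ is Σ^∃_d of the unit of x; both leave 2-cells unchanged, and naturality comes down
-- to M preserving Σ on a single generator.
module Submission where

open import Defs
open import Level using (Level)
open import Data.Product using (Σ-syntax; _,_; proj₁; proj₂) renaming (_×_ to _×ₜ_)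
open import Data.List using (List; []; _∷_; _++_; map)
open import Data.List.Membership.Propositional using (_∈_)
open import Data.List.Membership.Propositional.Properties using (∈-map⁺; ∈-++⁺ˡ)
open import Data.List.Properties using (map-++)
open import Data.List.Relation.Unary.Any using (here; there)
open import Data.List.Relation.Unary.All using ([]; _∷_)
open import Data.List.Relation.Binary.Pointwise as Pw using (Pointwise; []; _∷_)
open import Relation.Binary.PropositionalEquality using (_≡_; refl; sym; subst)

module ProductLemmas {a : Level} (C : CartCat a) where
  open CartCat C

  infixr 4 _■_
  _■_ : ∀ {A B} {f g h : Hom A B} → f ≈ g → g ≈ h → f ≈ h
  _■_ = ≈.trans

  ∘-resp-≈ˡ : ∀ {A B C'} {f g : Hom B C'} {h : Hom A B} → f ≈ g → f ∘ h ≈ g ∘ h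
  ∘-resp-≈ˡ p = ∘-resp-≈ p ≈.refl

  ∘-resp-≈ʳ : ∀ {A B C'} {f : Hom B C'} {g h : Hom A B} → g ≈ h → f ∘ g ≈ f ∘ h
  ∘-resp-≈ʳ p = ∘-resp-≈ ≈.refl p

  id-comm : ∀ {A B} {f : Hom A B} → f ∘ id ≈ id ∘ f
  id-comm = identityʳ ■ ≈.sym identityˡ

  id-comm-sym : ∀ {A B} {f : Hom A B} → id ∘ f ≈ f ∘ id
  id-comm-sym = ≈.sym id-comm

  ⟨⟩-cong : ∀ {X A B} {f f' : Hom X A} {g g' : Hom X B} → f ≈ f' → g ≈ g' → ⟨ f , g ⟩ ≈ ⟨ f' , g' ⟩
  ⟨⟩-cong p q = unique (project₁ ■ ≈.sym p) (project₂ ■ ≈.sym q)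

  project₁∘ : ∀ {Y X A B} {f : Hom X A} {g : Hom X B} {h : Hom Y X} → π₁ ∘ (⟨ f , g ⟩ ∘ h) ≈ f ∘ h
  project₁∘ = ≈.sym assoc ■ ∘-resp-≈ˡ project₁

  project₂∘ : ∀ {Y X A B} {f : Hom X A} {g : Hom X B} {h : Hom Y X} → π₂ ∘ (⟨ f , g ⟩ ∘ h) ≈ g ∘ h
  project₂∘ = ≈.sym assoc ■ ∘-resp-≈ˡ project₂

  ⟨⟩∘ : ∀ {Y X A B} {f : Hom X A} {g : Hom X B} {h : Hom Y X} → ⟨ f , g ⟩ ∘ h ≈ ⟨ f ∘ h , g ∘ h ⟩
  ⟨⟩∘ = ≈.sym (unique project₁∘ project₂∘)

  ×-ext : ∀ {X A B} {f g : Hom X (A × B)} → π₁ ∘ f ≈ π₁ ∘ g → π₂ ∘ f ≈ π₂ ∘ g → f ≈ g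
  ×-ext p q = ≈.sym (unique ≈.refl ≈.refl) ■ ⟨⟩-cong p q ■ unique ≈.refl ≈.refl

  π₁×id : ∀ {d e c} → Hom ((d × e) × c) (d × c)
  π₁×id = ⟨ π₁ ∘ π₁ , π₂ ⟩

  π₂×id : ∀ {d e c} → Hom ((d × e) × c) (e × c)
  π₂×id = ⟨ π₂ ∘ π₁ , π₂ ⟩

  assocˡ : ∀ {d e c} → Hom (d × (e × c)) ((d × e) × c)
  assocˡ = ⟨ ⟨ π₁ , π₁ ∘ π₂ ⟩ , π₂ ∘ π₂ ⟩

  π₁×id∘assocˡ : ∀ {d e c} → π₁×id {d} {e} {c} ∘ assocˡ ≈ ⟨ π₁ , π₂ ∘ π₂ ⟩
  π₁×id∘assocˡ = ×-ext (project₁∘ ■ assoc ■ ∘-resp-≈ʳ project₁ ■ project₁ ■ ≈.sym project₁)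
                       (project₂∘ ■ project₂ ■ ≈.sym project₂)

  π₂×id∘assocˡ : ∀ {d e c} → π₂×id {d} {e} {c} ∘ assocˡ ≈ π₂
  π₂×id∘assocˡ = ×-ext (project₁∘ ■ assoc ■ ∘-resp-≈ʳ project₁ ■ project₂) (project₂∘ ■ project₂)

  assocʳ∘assocˡ : ∀ {d e c} → assocʳ ∘ assocˡ {d} {e} {c} ≈ id
  assocʳ∘assocˡ = ×-ext (project₁∘ ■ assoc ■ ∘-resp-≈ʳ project₁ ■ project₁ ■ ≈.sym identityʳ)
                        (project₂∘ ■ π₂×id∘assocˡ ■ ≈.sym identityʳ)

  unit×id : ∀ {d c} → Hom (d × c) ((𝟙 × d) × c)
  unit×id = ⟨ ⟨ ! , π₁ ⟩ , π₂ ⟩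

  π₂∘assocʳ∘unit×id : ∀ {d c} → (π₂ ∘ assocʳ) ∘ unit×id {d} {c} ≈ id
  π₂∘assocʳ∘unit×id = ∘-resp-≈ˡ project₂ ■ ×-ext (project₁∘ ■ assoc ■ ∘-resp-≈ʳ project₁ ■ project₂ ■ ≈.sym identityʳ)
                                                  (project₂∘ ■ project₂ ■ ≈.sym identityʳ)

  π₂∘π₂∘assocʳ : ∀ {d e c} → (π₂ ∘ π₂) ∘ assocʳ {d} {e} {c} ≈ π₂
  π₂∘π₂∘assocʳ = assoc ■ ∘-resp-≈ʳ project₂ ■ project₂

module DLatLemmas {a : Level} {L : RawDLat a} (I : IsDLat L) where
  open RawDLat L
  open IsDLat I

  infixr 5 _⟫_
  _⟫_ : ∀ {x y z} → x ≤ y → y ≤ z → x ≤ z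
  _⟫_ = trans≤

  ∧-mono : ∀ {x y x' y'} → x ≤ x' → y ≤ y' → x ∧ y ≤ x' ∧ y'
  ∧-mono p q = ∧-glb (∧-lb₁ ⟫ p) (∧-lb₂ ⟫ q)

  ∨-mono : ∀ {x y x' y'} → x ≤ x' → y ≤ y' → x ∨ y ≤ x' ∨ y'
  ∨-mono p q = ∨-lub (p ⟫ ∨-ub₁) (q ⟫ ∨-ub₂)

  ∨-cong : ∀ {x y x' y'} → x ≃ x' → y ≃ y' → (x ∨ y) ≃ (x' ∨ y')
  ∨-cong (p , q) (r , s) = ∨-mono p r , ∨-mono q s

  ∧-comm : ∀ {x y} → x ∧ y ≤ y ∧ x
  ∧-comm = ∧-glb ∧-lb₂ ∧-lb₁

  ∧-distribˡ-∨ : ∀ {x y z} → (x ∧ (y ∨ z)) ≃ ((x ∧ y) ∨ (x ∧ z))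
  ∧-distribˡ-∨ = distrib , ∨-lub (∧-mono refl≤ ∨-ub₁) (∧-mono refl≤ ∨-ub₂)

  ∧-distribʳ-∨ : ∀ {x y z} → ((x ∨ y) ∧ z) ≃ ((x ∧ z) ∨ (y ∧ z))
  ∧-distribʳ-∨ = (∧-comm ⟫ distrib ⟫ ∨-mono ∧-comm ∧-comm) , ∨-lub (∧-mono ∨-ub₁ refl≤) (∧-mono ∨-ub₂ refl≤)

  ⋁-ub : ∀ {x xs} → x ∈ xs → x ≤ ⋁ xs
  ⋁-ub (here refl) = ∨-ub₁
  ⋁-ub (there m) = ⋁-ub m ⟫ ∨-ub₂

  ⋁-map-++ : ∀ {A : Set a} (f : A → Carrier) xs ys → ⋁ (map f (xs ++ ys)) ≃ (⋁ (map f xs) ∨ ⋁ (map f ys))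
  ⋁-map-++ f [] ys = ∨-ub₂ , ∨-lub ⊥-min refl≤
  ⋁-map-++ f (x ∷ xs) ys =
    ∨-mono refl≤ (proj₁ (⋁-map-++ f xs ys)) ⟫ ∨-lub (∨-ub₁ ⟫ ∨-ub₁) (∨-lub (∨-ub₂ ⟫ ∨-ub₁) ∨-ub₂) ,
    ∨-lub (∨-lub ∨-ub₁ (∨-ub₁ ⟫ proj₂ (⋁-map-++ f xs ys) ⟫ ∨-ub₂)) (∨-ub₂ ⟫ proj₂ (⋁-map-++ f xs ys) ⟫ ∨-ub₂)

pointwise-mapʳ : ∀ {a} {A B : Set a} {R : A → B → Set a} {f : A → B} → (∀ {u} → R u (f u)) →
                 ∀ xs → Pointwise R xs (map f xs)
pointwise-mapʳ r [] = []
pointwise-mapʳ r (x ∷ xs) = r ∷ pointwise-mapʳ r xs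

module ReindexLemmas {a : Level} {D : CartCat a} (Q : Doctrine D) where
  open CartCat D
  open ProductLemmas D
  module Q = Doctrine Q
  module L (c : Obj) = RawDLat (Q.fib c)
  module I (c : Obj) = IsDLat (Q.isDLat c)
  module LL (c : Obj) = DLatLemmas (Q.isDLat c)
  module RH {c d : Obj} (f : Hom c d) = IsLatHom (Q.reindex-hom f)
  open Q using (reindex) public

  Car : Obj → Set a
  Car c = L.Carrier c

  infixr 5 _⟫_
  _⟫_ : ∀ {c} {x y z : Car c} → L._≤_ c x y → L._≤_ c y z → L._≤_ c x z
  _⟫_ {c} = I.trans≤ c

  rfl : ∀ {c} {x : Car c} → L._≤_ c x x
  rfl {c} = I.refl≤ c

  ∧m : ∀ {c} {x y x' y' : Car c} → L._≤_ c x x' → L._≤_ c y y' → L._≤_ c (L._∧_ c x y) (L._∧_ c x' y')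
  ∧m {c} = LL.∧-mono c

  ∨m : ∀ {c} {x y x' y' : Car c} → L._≤_ c x x' → L._≤_ c y y' → L._≤_ c (L._∨_ c x y) (L._∨_ c x' y')
  ∨m {c} = LL.∨-mono c

  rmono : ∀ {c d} (f : Hom c d) {x y : Car d} → L._≤_ d x y → L._≤_ c (reindex f x) (reindex f y)
  rmono f = RH.mono f

  rresp : ∀ {c d} {f g : Hom c d} → f ≈ g → ∀ {x} → L._≤_ c (reindex f x) (reindex g x)
  rresp p {x} = proj₁ (Q.reindex-resp p x)

  r∘⇒ : ∀ {c d e} {f : Hom c d} {g : Hom d e} {x} → L._≤_ c (reindex (g ∘ f) x) (reindex f (reindex g x))
  r∘⇒ {f = f} {g} {x} = proj₁ (Q.reindex-∘ f g x)

  r∘⇐ : ∀ {c d e} {f : Hom c d} {g : Hom d e} {x} → L._≤_ c (reindex f (reindex g x)) (reindex (g ∘ f) x)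
  r∘⇐ {f = f} {g} {x} = proj₂ (Q.reindex-∘ f g x)

  rid⇒ : ∀ {c} {x : Car c} → L._≤_ c (reindex id x) x
  rid⇒ {x = x} = proj₁ (Q.reindex-id x)

  rid⇐ : ∀ {c} {x : Car c} → L._≤_ c x (reindex id x)
  rid⇐ {x = x} = proj₂ (Q.reindex-id x)

  rfuse : ∀ {c d e} {f : Hom c d} {g : Hom d e} {h : Hom c e} → g ∘ f ≈ h → ∀ {x} →
          L._≤_ c (reindex f (reindex g x)) (reindex h x)
  rfuse p = r∘⇐ ⟫ rresp p

  rsplit : ∀ {c d e} {f : Hom c d} {g : Hom d e} {h : Hom c e} → g ∘ f ≈ h → ∀ {x} →
           L._≤_ c (reindex h x) (reindex f (reindex g x))
  rsplit p = rresp (≈.sym p) ⟫ r∘⇒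

  rswap : ∀ {c d d' e} {f : Hom c d} {g : Hom d e} {f' : Hom c d'} {g' : Hom d' e} → g ∘ f ≈ g' ∘ f' → ∀ {x} →
          L._≤_ c (reindex f (reindex g x)) (reindex f' (reindex g' x))
  rswap p = rfuse p ⟫ r∘⇒

  r∧⇒ : ∀ {c d} (f : Hom c d) {x y : Car d} → L._≤_ c (reindex f (L._∧_ d x y)) (L._∧_ c (reindex f x) (reindex f y))
  r∧⇒ f {x} {y} = proj₁ (RH.pres-∧ f x y)

  r∧⇐ : ∀ {c d} (f : Hom c d) {x y : Car d} → L._≤_ c (L._∧_ c (reindex f x) (reindex f y)) (reindex f (L._∧_ d x y))
  r∧⇐ f {x} {y} = proj₂ (RH.pres-∧ f x y)

  r⊤ : ∀ {c d} (f : Hom c d) → L._≤_ c (L.⊤ c) (reindex f (L.⊤ d))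
  r⊤ f = proj₂ (RH.pres-⊤ f)

module ExistsLemmas {a : Level} {D : CartCat a} (Q : ExDoctrine D) where
  open CartCat D
  open ProductLemmas D
  open ReindexLemmas (ExDoctrine.doc Q) public
  open ExDoctrine Q using (exists; adj-⇒; adj-⇐; frobenius; beck-chevalley) public

  Σ' : ∀ {d c} → Car (d × c) → Car c
  Σ' {d} {c} = exists d c

  Σ-unit : ∀ {d c} {y : Car (d × c)} → L._≤_ (d × c) y (reindex π₂ (Σ' y))
  Σ-unit {y = y} = adj-⇒ y _ rfl

  Σ-lub : ∀ {d c} {y : Car (d × c)} {x : Car c} → L._≤_ (d × c) y (reindex π₂ x) → L._≤_ c (Σ' y) x
  Σ-lub {y = y} {x} p = adj-⇐ y x p

  Σ-mono : ∀ {d c} {y y' : Car (d × c)} → L._≤_ (d × c) y y' → L._≤_ c (Σ' {d} y) (Σ' y')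
  Σ-mono p = Σ-lub (p ⟫ Σ-unit)

  Σ-mono-reindex : ∀ {d c d' c'} (s : Hom (d × c) (d' × c')) (h : Hom c c') → π₂ ∘ s ≈ h ∘ π₂ →
                   ∀ {w w'} → L._≤_ (d × c) w (reindex s w') → L._≤_ c (Σ' {d} w) (reindex h (Σ' {d'} w'))
  Σ-mono-reindex s h e p = Σ-lub (p ⟫ rmono s Σ-unit ⟫ rswap e)

  Σ-mono-along : ∀ {d c d'} (s : Hom (d × c) (d' × c)) → π₂ ∘ s ≈ π₂ →
                 ∀ {w w'} → L._≤_ (d × c) w (reindex s w') → L._≤_ c (Σ' {d} w) (Σ' {d'} w')
  Σ-mono-along s e p = Σ-mono-reindex s id (e ■ ≈.sym identityˡ) p ⟫ rid⇒

  Σ-intro : ∀ {d c} (s : Hom c (d × c)) → π₂ ∘ s ≈ id → ∀ {y z} → L._≤_ c y (reindex s z) → L._≤_ c y (Σ' {d} z)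
  Σ-intro s e p = p ⟫ rmono s Σ-unit ⟫ rfuse e ⟫ rid⇒

  Σ-∨ : ∀ {d c} {y z : Car (d × c)} → L._≤_ c (Σ' (L._∨_ (d × c) y z)) (L._∨_ c (Σ' y) (Σ' z))
  Σ-∨ {d} {c} = Σ-lub (I.∨-lub (d × c) (Σ-unit ⟫ rmono π₂ (I.∨-ub₁ c)) (Σ-unit ⟫ rmono π₂ (I.∨-ub₂ c)))

  Σ-⊥ : ∀ {d c} → L._≤_ c (Σ' {d} (L.⊥ (d × c))) (L.⊥ c)
  Σ-⊥ {d} {c} = Σ-lub (I.⊥-min (d × c))

  -- Frobenius for Σ_d and then for Σ_e, with Beck–Chevalley moving Σ_d x under π₂^*.
  Σ∧Σ⇒ : ∀ {d e c} {x : Car (d × c)} {y : Car (e × c)} →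
         L._≤_ c (L._∧_ c (Σ' x) (Σ' y)) (Σ' {d × e} (L._∧_ _ (reindex π₁×id x) (reindex π₂×id y)))
  Σ∧Σ⇒ {d} {e} {c} {x} {y} = proj₁ (frobenius (Σ' x) y) ⟫ Σ-lub outer
    where
      S : Car c
      S = Σ' {d × e} (L._∧_ _ (reindex π₁×id x) (reindex π₂×id y))
      inner : L._≤_ (d × (e × c)) (L._∧_ _ (reindex π₂ y) (reindex (id× π₂) x)) (reindex π₂ (reindex π₂ S))
      inner = ∧m (rsplit π₂×id∘assocˡ) (rsplit π₁×id∘assocˡ) ⟫ LL.∧-comm _ ⟫ r∧⇐ assocˡ
              ⟫ rmono assocˡ Σ-unit ⟫ rfuse project₂ ⟫ r∘⇒
      outer : L._≤_ (e × c) (L._∧_ _ (reindex π₂ (Σ' x)) y) (reindex π₂ S)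
      outer = ∧m (proj₁ (beck-chevalley π₂ x)) rfl ⟫ LL.∧-comm _ ⟫ proj₁ (frobenius y _) ⟫ Σ-lub inner

  Σ∧Σ⇐ : ∀ {d e c} {x : Car (d × c)} {y : Car (e × c)} →
         L._≤_ c (Σ' {d × e} (L._∧_ _ (reindex π₁×id x) (reindex π₂×id y))) (L._∧_ c (Σ' x) (Σ' y))
  Σ∧Σ⇐ {c = c} = I.∧-glb c (Σ-mono-along π₁×id project₂ (I.∧-lb₁ _)) (Σ-mono-along π₂×id project₂ (I.∧-lb₂ _))

  ΣΣ⇒ : ∀ {d e c} {w : Car (e × (d × c))} → L._≤_ c (Σ' {d} (Σ' {e} w)) (Σ' {e × d} (reindex assocʳ w))
  ΣΣ⇒ = Σ-lub (Σ-lub (rid⇐ ⟫ rsplit assocʳ∘assocˡ ⟫ rmono assocˡ Σ-unit ⟫ rfuse project₂ ⟫ r∘⇒))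

  ΣΣ⇐ : ∀ {d e c} {w : Car (e × (d × c))} → L._≤_ c (Σ' {e × d} (reindex assocʳ w)) (Σ' {d} (Σ' {e} w))
  ΣΣ⇐ = Σ-lub (rmono assocʳ (Σ-unit ⟫ rmono π₂ Σ-unit ⟫ r∘⇐) ⟫ rfuse π₂∘π₂∘assocʳ)

module FPFunctorLemmas {a : Level} {C D : CartCat a} (F : FPFunctor C D) where
  private
    module C = CartCat C
  open CartCat D
  open ProductLemmas D
  open FPFunctor F

  ψ : ∀ d c → Hom (F₀ (d C.× c)) (F₀ d × F₀ c)
  ψ d c = ⟨ F₁ C.π₁ , F₁ C.π₂ ⟩

  Fπ₁∘φ : ∀ {d c} → F₁ C.π₁ ∘ φ d c ≈ π₁
  Fπ₁∘φ {d} {c} = ∘-resp-≈ˡ (≈.sym project₁) ■ assoc ■ ∘-resp-≈ʳ (φ-r d c) ■ identityʳ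

  Fπ₂∘φ : ∀ {d c} → F₁ C.π₂ ∘ φ d c ≈ π₂
  Fπ₂∘φ {d} {c} = ∘-resp-≈ˡ (≈.sym project₂) ■ assoc ■ ∘-resp-≈ʳ (φ-r d c) ■ identityʳ

  Fπ₁∘φ∘ : ∀ {X d c} {h : Hom X (F₀ d × F₀ c)} → F₁ C.π₁ ∘ (φ d c ∘ h) ≈ π₁ ∘ h
  Fπ₁∘φ∘ = ≈.sym assoc ■ ∘-resp-≈ˡ Fπ₁∘φ

  Fπ₂∘φ∘ : ∀ {X d c} {h : Hom X (F₀ d × F₀ c)} → F₁ C.π₂ ∘ (φ d c ∘ h) ≈ π₂ ∘ h
  Fπ₂∘φ∘ = ≈.sym assoc ■ ∘-resp-≈ˡ Fπ₂∘φ

  F×-ext : ∀ {X d c} {f g : Hom X (F₀ (d C.× c))} →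
           F₁ C.π₁ ∘ f ≈ F₁ C.π₁ ∘ g → F₁ C.π₂ ∘ f ≈ F₁ C.π₂ ∘ g → f ≈ g
  F×-ext {d = d} {c} p q =
    ≈.sym identityˡ ■ ∘-resp-≈ˡ (≈.sym (φ-l d c)) ■ assoc ■ ∘-resp-≈ʳ (⟨⟩∘ ■ ⟨⟩-cong p q ■ ≈.sym ⟨⟩∘)
    ■ ≈.sym assoc ■ ∘-resp-≈ˡ (φ-l d c) ■ identityˡ

  F∘∘ : ∀ {A B C' X} {f : C.Hom A B} {g : C.Hom B C'} {h : Hom X (F₀ A)} →
        F₁ (g C.∘ f) ∘ h ≈ F₁ g ∘ (F₁ f ∘ h)
  F∘∘ = ∘-resp-≈ˡ homomorphism ■ assoc

  F-pull : ∀ {A B C' X} {f : C.Hom A B} {g : C.Hom B C'} {k : C.Hom A C'} {h : Hom X (F₀ A)} →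
           g C.∘ f C.≈ k → F₁ g ∘ (F₁ f ∘ h) ≈ F₁ k ∘ h
  F-pull p = ≈.sym F∘∘ ■ ∘-resp-≈ˡ (F-resp-≈ p)

module MorphismLemmas {a : Level} {C D : CartCat a} (P : Doctrine C) (Q : Doctrine D)
                      (X : DocMor (Doctrine.raw P) (Doctrine.raw Q)) where
  private
    module C = CartCat C
    module CL = ProductLemmas C
    module P = Doctrine P
    module X = DocMor X
    module PL (c : C.Obj) = RawDLat (P.fib c)
    module XH (c : C.Obj) = IsLatHom (X.α-hom c)
  open CartCat D
  open ProductLemmas D
  open ReindexLemmas Q
  open FPFunctorLemmas X.F

  αn⇒ : ∀ {c d} (f : C.Hom c d) {x} → L._≤_ _ (X.α c (P.reindex f x)) (reindex (X.F₁ f) (X.α d x))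
  αn⇒ f {x} = proj₁ (X.α-nat f x)

  αn⇐ : ∀ {c d} (f : C.Hom c d) {x} → L._≤_ _ (reindex (X.F₁ f) (X.α d x)) (X.α c (P.reindex f x))
  αn⇐ f {x} = proj₂ (X.α-nat f x)

  αm : ∀ {c} {x y} → PL._≤_ c x y → L._≤_ _ (X.α c x) (X.α c y)
  αm {c} = XH.mono c

  αφ : ∀ d c → PL.Carrier (d C.× c) → Car (X.F₀ d × X.F₀ c)
  αφ d c x = reindex (X.φ d c) (X.α (d C.× c) x)

  module _ {c d e : C.Obj} (r : C.Hom (d C.× c) (e C.× c)) (cm : C.π₂ C.∘ r C.≈ C.π₂) where
    liftArr : Hom (X.F₀ d × X.F₀ c) (X.F₀ e × X.F₀ c)
    liftArr = ψ e c ∘ (X.F₁ r ∘ X.φ d c)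

    liftArr-comm : π₂ ∘ liftArr ≈ π₂
    liftArr-comm = project₂∘ ■ F-pull cm ■ Fπ₂∘φ

    αφ-liftArr : ∀ {y} → L._≤_ _ (αφ d c (P.reindex r y)) (reindex liftArr (αφ e c y))
    αφ-liftArr = rmono _ (αn⇒ r) ⟫ rswap Fr∘φ
      where
        Fr∘φ : X.F₁ r ∘ X.φ d c ≈ X.φ e c ∘ liftArr
        Fr∘φ = ≈.sym (≈.sym assoc ■ ∘-resp-≈ˡ (X.φ-l e c) ■ identityˡ)

  module _ {d e c : C.Obj} where
    ψ×id : Hom (X.F₀ (d C.× e) × X.F₀ c) ((X.F₀ d × X.F₀ e) × X.F₀ c)
    ψ×id = ⟨ ψ d e ∘ π₁ , π₂ ⟩

    φ×id : Hom ((X.F₀ d × X.F₀ e) × X.F₀ c) (X.F₀ (d C.× e) × X.F₀ c)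
    φ×id = ⟨ X.φ d e ∘ π₁ , π₂ ⟩

    Fπ₁×id∘φ : X.F₁ CL.π₁×id ∘ X.φ (d C.× e) c ≈ (X.φ d c ∘ π₁×id) ∘ ψ×id
    Fπ₁×id∘φ =
      F×-ext (F-pull C.project₁ ■ F∘∘ ■ ∘-resp-≈ʳ Fπ₁∘φ
              ■ ≈.sym (∘-resp-≈ʳ assoc ■ Fπ₁∘φ∘ ■ project₁∘ ■ assoc ■ ∘-resp-≈ʳ project₁ ■ project₁∘))
             (F-pull C.project₂ ■ Fπ₂∘φ ■ ≈.sym (∘-resp-≈ʳ assoc ■ Fπ₂∘φ∘ ■ project₂∘ ■ project₂))

    Fπ₂×id∘φ : X.F₁ CL.π₂×id ∘ X.φ (d C.× e) c ≈ (X.φ e c ∘ π₂×id) ∘ ψ×id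
    Fπ₂×id∘φ =
      F×-ext (F-pull C.project₁ ■ F∘∘ ■ ∘-resp-≈ʳ Fπ₁∘φ
              ■ ≈.sym (∘-resp-≈ʳ assoc ■ Fπ₁∘φ∘ ■ project₁∘ ■ assoc ■ ∘-resp-≈ʳ project₁ ■ project₂∘))
             (F-pull C.project₂ ■ Fπ₂∘φ ■ ≈.sym (∘-resp-≈ʳ assoc ■ Fπ₂∘φ∘ ■ project₂∘ ■ project₂))

    φ∘π₁×id : X.φ d c ∘ π₁×id ≈ (X.F₁ CL.π₁×id ∘ X.φ (d C.× e) c) ∘ φ×id
    φ∘π₁×id =
      F×-ext (Fπ₁∘φ∘ ■ project₁
              ■ ≈.sym (∘-resp-≈ʳ assoc ■ F-pull C.project₁ ■ F∘∘ ■ ∘-resp-≈ʳ Fπ₁∘φ∘ ■ ∘-resp-≈ʳ project₁ ■ Fπ₁∘φ∘))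
             (Fπ₂∘φ∘ ■ project₂ ■ ≈.sym (∘-resp-≈ʳ assoc ■ F-pull C.project₂ ■ Fπ₂∘φ∘ ■ project₂))

    φ∘π₂×id : X.φ e c ∘ π₂×id ≈ (X.F₁ CL.π₂×id ∘ X.φ (d C.× e) c) ∘ φ×id
    φ∘π₂×id =
      F×-ext (Fπ₁∘φ∘ ■ project₁
              ■ ≈.sym (∘-resp-≈ʳ assoc ■ F-pull C.project₁ ■ F∘∘ ■ ∘-resp-≈ʳ Fπ₁∘φ∘ ■ ∘-resp-≈ʳ project₁ ■ Fπ₂∘φ∘))
             (Fπ₂∘φ∘ ■ project₂ ■ ≈.sym (∘-resp-≈ʳ assoc ■ F-pull C.project₂ ■ Fπ₂∘φ∘ ■ project₂))

    αφ-∧⇒ : ∀ {x y} → L._≤_ _ (αφ (d C.× e) c (PL._∧_ _ (P.reindex CL.π₁×id x) (P.reindex CL.π₂×id y)))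
                              (reindex ψ×id (L._∧_ _ (reindex π₁×id (αφ d c x)) (reindex π₂×id (αφ e c y))))
    αφ-∧⇒ = rmono _ (proj₁ (XH.pres-∧ _ _ _)) ⟫ r∧⇒ _
          ⟫ ∧m (rmono _ (αn⇒ CL.π₁×id) ⟫ rswap Fπ₁×id∘φ ⟫ rmono ψ×id r∘⇒)
               (rmono _ (αn⇒ CL.π₂×id) ⟫ rswap Fπ₂×id∘φ ⟫ rmono ψ×id r∘⇒)
          ⟫ r∧⇐ ψ×id

    αφ-∧⇐ : ∀ {x y} → L._≤_ _ (L._∧_ _ (reindex π₁×id (αφ d c x)) (reindex π₂×id (αφ e c y)))
                              (reindex φ×id (αφ (d C.× e) c (PL._∧_ _ (P.reindex CL.π₁×id x) (P.reindex CL.π₂×id y))))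
    αφ-∧⇐ = ∧m (r∘⇐ ⟫ rresp φ∘π₁×id ⟫ r∘⇒ ⟫ rmono φ×id (r∘⇒ ⟫ rmono _ (αn⇐ CL.π₁×id)))
               (r∘⇐ ⟫ rresp φ∘π₂×id ⟫ r∘⇒ ⟫ rmono φ×id (r∘⇒ ⟫ rmono _ (αn⇐ CL.π₂×id)))
          ⟫ r∧⇐ φ×id ⟫ rmono φ×id (r∧⇐ _ ⟫ rmono _ (proj₂ (XH.pres-∧ _ _ _)))

  module _ {d c c' : C.Obj} (f : C.Hom c' c) where
    Fid×∘φ : X.F₁ (C.id×_ {d} f) ∘ X.φ d c' ≈ X.φ d c ∘ (id× X.F₁ f)
    Fid×∘φ = F×-ext (F-pull C.project₁ ■ Fπ₁∘φ ■ ≈.sym (Fπ₁∘φ∘ ■ project₁))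
                    (F-pull C.project₂ ■ F∘∘ ■ ∘-resp-≈ʳ Fπ₂∘φ ■ ≈.sym (Fπ₂∘φ∘ ■ project₂))

    αφ-reindex⇒ : ∀ {x} → L._≤_ _ (αφ d c' (P.reindex (C.id×_ {d} f) x)) (reindex (id× X.F₁ f) (αφ d c x))
    αφ-reindex⇒ = rmono _ (αn⇒ _) ⟫ rswap Fid×∘φ

    αφ-reindex⇐ : ∀ {x} → L._≤_ _ (reindex (id× X.F₁ f) (αφ d c x)) (αφ d c' (P.reindex (C.id×_ {d} f) x))
    αφ-reindex⇐ = rswap (≈.sym Fid×∘φ) ⟫ rmono _ (αn⇐ _)

  module _ {e d c : C.Obj} where
    Fassocʳ∘φ : X.F₁ (C.assocʳ {e} {d} {c}) ∘ X.φ (e C.× d) c ≈ ((X.φ e (d C.× c) ∘ id× X.φ d c) ∘ assocʳ) ∘ ψ×id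
    Fassocʳ∘φ =
      F×-ext (F-pull C.project₁ ■ F∘∘ ■ ∘-resp-≈ʳ Fπ₁∘φ
              ■ ≈.sym (∘-resp-≈ʳ (assoc ■ assoc) ■ Fπ₁∘φ∘ ■ project₁∘ ■ project₁∘ ■ assoc ■ ∘-resp-≈ʳ project₁ ■ project₁∘))
             (F-pull C.project₂ ■ Fπ₂×id∘φ ■ assoc
              ■ ≈.sym (∘-resp-≈ʳ (assoc ■ assoc) ■ Fπ₂∘φ∘ ■ project₂∘ ■ assoc ■ ∘-resp-≈ʳ project₂∘))

    φ∘id×φ∘assocʳ : (X.φ e (d C.× c) ∘ id× X.φ d c) ∘ assocʳ ≈ (X.F₁ (C.assocʳ {e} {d} {c}) ∘ X.φ (e C.× d) c) ∘ φ×id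
    φ∘id×φ∘assocʳ =
      F×-ext (∘-resp-≈ʳ assoc ■ Fπ₁∘φ∘ ■ project₁∘ ■ project₁
              ■ ≈.sym (∘-resp-≈ʳ assoc ■ F-pull C.project₁ ■ F∘∘ ■ ∘-resp-≈ʳ Fπ₁∘φ∘ ■ ∘-resp-≈ʳ project₁ ■ Fπ₁∘φ∘))
             (∘-resp-≈ʳ assoc ■ Fπ₂∘φ∘ ■ project₂∘ ■ assoc ■ ∘-resp-≈ʳ project₂ ■ φ∘π₂×id
              ■ ≈.sym (∘-resp-≈ʳ assoc ■ F-pull C.project₂ ■ ≈.sym assoc))

    αφ-assoc⇒ : ∀ {y} → L._≤_ _ (αφ (e C.× d) c (P.reindex C.assocʳ y))
                                (reindex ψ×id (reindex assocʳ (reindex (id× X.φ d c) (αφ e (d C.× c) y))))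
    αφ-assoc⇒ = rmono _ (αn⇒ _) ⟫ rfuse Fassocʳ∘φ ⟫ r∘⇒ ⟫ rmono ψ×id (r∘⇒ ⟫ rmono assocʳ r∘⇒)

    αφ-assoc⇐ : ∀ {y} → L._≤_ _ (reindex assocʳ (reindex (id× X.φ d c) (αφ e (d C.× c) y)))
                                (reindex φ×id (αφ (e C.× d) c (P.reindex C.assocʳ y)))
    αφ-assoc⇐ = rmono assocʳ r∘⇐ ⟫ r∘⇐ ⟫ rresp φ∘id×φ∘assocʳ ⟫ r∘⇒ ⟫ rmono φ×id (r∘⇒ ⟫ rmono _ (αn⇐ _))

module CoverLemmas {a : Level} {C : CartCat a} (P : Doctrine C) where
  open CartCat C
  open ReindexLemmas P public

  PR : RawDoctrine C
  PR = Doctrine.raw P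

  covered-by : ∀ {c d e} {x : Car (d × c)} {y : Car (e × c)} {ys : List (Elem PR c)}
               (r : Hom (d × c) (e × c)) → π₂ ∘ r ≈ π₂ → (e , y) ∈ ys → L._≤_ _ x (reindex r y) →
               Covered PR c (d , x) ys
  covered-by r cm m p = (record { tgt = _ ; mem = m ; arr = r ; comm = cm } ∷ []) , p ⟫ I.∨-ub₁ _

  covered-weaken : ∀ {c} {u : Elem PR c} {ys zs : List (Elem PR c)} → (∀ {v} → v ∈ ys → v ∈ zs) →
                   Covered PR c u ys → Covered PR c u zs
  covered-weaken {c} {d , x} {ys} {zs} ys⊆zs (ws , le) = map weaken ws , le ⟫ go ws
    where
      weaken : Witness PR c d ys → Witness PR c d zs
      weaken w = record { tgt = Witness.tgt w ; mem = ys⊆zs (Witness.mem w) ; arr = Witness.arr w ; comm = Witness.comm w }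
      go : ∀ ws → L._≤_ _ (L.⋁ _ (map (λ w → reindex (Witness.arr w) (proj₂ (Witness.tgt w))) ws))
                           (L.⋁ _ (map (λ w → reindex (Witness.arr w) (proj₂ (Witness.tgt w))) (map weaken ws)))
      go [] = rfl
      go (w ∷ ws) = ∨m rfl (go ws)

  ≤∃-weaken : ∀ {c} {xs ys zs : List (Elem PR c)} → (∀ {v} → v ∈ ys → v ∈ zs) → _≤∃_ PR xs ys → _≤∃_ PR xs zs
  ≤∃-weaken ys⊆zs [] = []
  ≤∃-weaken ys⊆zs (p ∷ ps) = covered-weaken ys⊆zs p ∷ ≤∃-weaken ys⊆zs ps

  _≼_ : ∀ {c} → Elem PR c → Elem PR c → Set a
  u ≼ v = Covered PR _ u (v ∷ [])

  _∼_ : ∀ {c} → Elem PR c → Elem PR c → Set a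
  u ∼ v = u ≼ v ×ₜ v ≼ u

  ≼-by : ∀ {c d e} {x : Car (d × c)} {y : Car (e × c)}
         (r : Hom (d × c) (e × c)) → π₂ ∘ r ≈ π₂ → L._≤_ _ x (reindex r y) → (d , x) ≼ (e , y)
  ≼-by r cm = covered-by r cm (here refl)

  pointwise⇒≤∃ : ∀ {c} {xs ys : List (Elem PR c)} → Pointwise _≼_ xs ys → _≤∃_ PR xs ys
  pointwise⇒≤∃ [] = []
  pointwise⇒≤∃ (p ∷ ps) = covered-weaken ∈-++⁺ˡ p ∷ ≤∃-weaken there (pointwise⇒≤∃ ps)

  pointwise⇒≃∃ : ∀ {c} {xs ys : List (Elem PR c)} → Pointwise _∼_ xs ys → _≤∃_ PR xs ys ×ₜ _≤∃_ PR ys xs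
  pointwise⇒≃∃ p = pointwise⇒≤∃ (Pw.map proj₁ p) , pointwise⇒≤∃ (Pw.symmetric proj₂ p)

  ≤∃-refl : ∀ {c} (xs : List (Elem PR c)) → _≤∃_ PR xs xs
  ≤∃-refl xs = pointwise⇒≤∃ (Pw.refl (≼-by id identityʳ rid⇐))

  ≡⇒≤∃ : ∀ {c} {xs ys : List (Elem PR c)} → xs ≡ ys → _≤∃_ PR xs ys
  ≡⇒≤∃ {xs = xs} refl = ≤∃-refl xs

module LiftLaws {a : Level} {C' C : CartCat a} (P' : Doctrine C') (P : Doctrine C)
                (L : DocMor (Doctrine.raw P') (Doctrine.raw P)) where
  private
    module C' = CartCat C'
    P'R : RawDoctrine C'
    P'R = Doctrine.raw P'
    module LM = DocMor L
    module P' = Doctrine P'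
    module P'L (c : C'.Obj) = RawDLat (P'.fib c)
    module P'∃ = RawExDoctrine (ExComp P'R)
    module P'∃L (c : C'.Obj) = RawDLat (P'∃.fib c)
    module P∃ = RawExDoctrine (ExComp (Doctrine.raw P))
    module P∃L (c : CartCat.Obj C) = RawDLat (P∃.fib c)
    module LH (c : C'.Obj) = IsLatHom (LM.α-hom c)
  open CartCat C
  open CoverLemmas P
  open MorphismLemmas P' P L

  liftElem : ∀ c → Elem P'R c → Elem PR (LM.F₀ c)
  liftElem c u = LM.F₀ (proj₁ u) , αφ (proj₁ u) c (proj₂ u)

  lift-covered : ∀ {c} ys (u : Elem P'R c) → Covered P'R c u ys →
                 Covered PR (LM.F₀ c) (liftElem c u) (map (liftElem c) ys)
  lift-covered {c} ys (d , x) (ws , le) = map liftWitness ws , rmono _ (αm le) ⟫ go ws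
    where
      liftWitness : Witness P'R c d ys → Witness PR (LM.F₀ c) (LM.F₀ d) (map (liftElem c) ys)
      liftWitness w = record
        { tgt = liftElem c (Witness.tgt w) ; mem = ∈-map⁺ (liftElem c) (Witness.mem w)
        ; arr = liftArr (Witness.arr w) (Witness.comm w) ; comm = liftArr-comm (Witness.arr w) (Witness.comm w) }
      go : ∀ ws → L._≤_ _ (αφ d c (P'L.⋁ _ (map (λ w → P'.reindex (Witness.arr w) (proj₂ (Witness.tgt w))) ws)))
                           (L.⋁ _ (map (λ w → reindex (Witness.arr w) (proj₂ (Witness.tgt w))) (map liftWitness ws)))
      go [] = rmono _ (proj₁ (LH.pres-⊥ _)) ⟫ proj₁ (RH.pres-⊥ _)
      go (w ∷ ws) = rmono _ (proj₁ (LH.pres-∨ _ _ _)) ⟫ proj₁ (RH.pres-∨ _ _ _)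
                    ⟫ ∨m (αφ-liftArr (Witness.arr w) (Witness.comm w)) (go ws)

  lift-mono : ∀ {c} {xs ys : List (Elem P'R c)} → _≤∃_ P'R xs ys → _≤∃_ PR (map (liftElem c) xs) (map (liftElem c) ys)
  lift-mono [] = []
  lift-mono {ys = ys} (p ∷ ps) = lift-covered ys _ p ∷ lift-mono ps

  lift-⊤ : ∀ c → liftElem c (C'.𝟙 , P'L.⊤ (C'.𝟙 C'.× c)) ∼ (𝟙 , L.⊤ (𝟙 × LM.F₀ c))
  lift-⊤ c = ≼-by ⟨ ! , π₂ ⟩ project₂ (I.⊤-max _ ⟫ r⊤ _) ,
             ≼-by ⟨ LM.𝟙-inv ∘ π₁ , π₂ ⟩ project₂ (r⊤ _ ⟫ rmono _ (r⊤ _ ⟫ rmono _ (proj₂ (LH.pres-⊤ _))))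

  lift-∧ : ∀ c xs ys → Pointwise _∼_ (map (liftElem c) (P'∃L._∧_ c xs ys))
                                     (P∃L._∧_ _ (map (liftElem c) xs) (map (liftElem c) ys))
  lift-∧ c [] ys = []
  lift-∧ c (u ∷ xs) ys =
    subst (λ l → Pointwise _∼_ l (map (meetElem PR (liftElem c u)) (map (liftElem c) ys) ++ _))
          (sym (map-++ (liftElem c) (map (meetElem P'R u) ys) (P'∃L._∧_ c xs ys)))
      (Pw.++⁺ (Pw.map⁺ (liftElem c) (meetElem PR (liftElem c u)) (Pw.map⁺ (meetElem P'R u) (liftElem c) (Pw.refl meet∼)))
              (lift-∧ c xs ys))
    where
      meet∼ : ∀ {v} → liftElem c (meetElem P'R u v) ∼ meetElem PR (liftElem c u) (liftElem c v)
      meet∼ = ≼-by ψ×id project₂ αφ-∧⇒ , ≼-by φ×id project₂ αφ-∧⇐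

  lift-reindex : ∀ {c c'} (f : C'.Hom c' c) xs →
                 Pointwise _∼_ (map (liftElem c') (P'∃.reindex f xs))
                               (P∃.reindex (LM.F₁ f) (map (liftElem c) xs))
  lift-reindex f xs = Pw.map⁺ _ _ (Pw.map⁺ _ _ (Pw.refl
    (≼-by id identityʳ (αφ-reindex⇒ f ⟫ rid⇐) , ≼-by id identityʳ (αφ-reindex⇐ f ⟫ rid⇐))))

  lift-Σ : ∀ d c ys →
           Pointwise _∼_ (map (liftElem c) (P'∃.exists d c ys))
                         (P∃.exists (LM.F₀ d) (LM.F₀ c) (P∃.reindex (LM.φ d c) (map (liftElem (d C'.× c)) ys)))
  lift-Σ d c ys = Pw.map⁺ _ _ (Pw.map⁺ _ _ (pointwise-mapʳ
    (≼-by ψ×id project₂ αφ-assoc⇒ , ≼-by φ×id project₂ αφ-assoc⇐) ys))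

  liftLaws : ExtLaws L
  liftLaws =
    record
      { α-hom = λ c → record
        { mono = lift-mono
        ; pres-⊤ = pointwise⇒≃∃ (lift-⊤ c ∷ [])
        ; pres-⊥ = [] , []
        ; pres-∧ = λ xs ys → pointwise⇒≃∃ (lift-∧ c xs ys)
        ; pres-∨ = λ xs ys → ≡⇒≤∃ (map-++ (liftElem c) xs ys) , ≡⇒≤∃ (sym (map-++ (liftElem c) xs ys)) }
      ; α-nat = λ f xs → pointwise⇒≃∃ (lift-reindex f xs) } ,
    λ d c ys → pointwise⇒≃∃ (lift-Σ d c ys)

idFP : ∀ {a} (C : CartCat a) → FPFunctor C C
idFP C = record
  { functor = idF
  ; 𝟙-inv = id
  ; 𝟙-inv-l = identityˡ ■ ≈.sym (!-unique id)
  ; 𝟙-inv-r = identityʳ ■ ≈.sym (!-unique id)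
  ; φ = λ d c → id
  ; φ-l = λ d c → identityˡ ■ unique identityʳ identityʳ
  ; φ-r = λ d c → identityʳ ■ unique identityʳ identityʳ }
  where
    open CartCat C
    open ProductLemmas C

module Counit {a : Level} {D : CartCat a} (Q : ExDoctrine D) where
  private
    QR : RawDoctrine D
    QR = ExDoctrine.raw Q
    module Q∃ = RawExDoctrine (ExComp QR)
    module Q∃L (c : CartCat.Obj D) = RawDLat (Q∃.fib c)
  open CartCat D
  open ExistsLemmas Q

  collapse : ∀ c → List (Elem QR c) → Car c
  collapse c ys = L.⋁ c (map (λ u → Σ' (proj₂ u)) ys)

  collapse-covered : ∀ {c} ys (u : Elem QR c) → Covered QR c u ys → L._≤_ c (Σ' (proj₂ u)) (collapse c ys)
  collapse-covered ys (d , x) (ws , le) = Σ-mono le ⟫ go ws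
    where
      go : ∀ ws → L._≤_ _ (Σ' (L.⋁ _ (map (λ w → reindex (Witness.arr w) (proj₂ (Witness.tgt w))) ws)))
                           (collapse _ ys)
      go [] = Σ-⊥ ⟫ I.⊥-min _
      go (w ∷ ws) = Σ-∨ ⟫ I.∨-lub _ (Σ-mono-along (Witness.arr w) (Witness.comm w) rfl
                                     ⟫ LL.⋁-ub _ (∈-map⁺ (λ u → Σ' (proj₂ u)) (Witness.mem w)))
                                    (go ws)

  collapse-mono : ∀ {c} {xs ys : List (Elem QR c)} → _≤∃_ QR xs ys → L._≤_ c (collapse c xs) (collapse c ys)
  collapse-mono [] = I.⊥-min _
  collapse-mono {ys = ys} (p ∷ ps) = I.∨-lub _ (collapse-covered ys _ p) (collapse-mono ps)

  collapse-⊤ : ∀ c → L._≃_ c (collapse c (Q∃L.⊤ c)) (L.⊤ c)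
  collapse-⊤ c = I.⊤-max _ , Σ-intro ⟨ ! , id ⟩ project₂ (r⊤ _) ⟫ I.∨-ub₁ _

  collapse-∨ : ∀ c xs ys → L._≃_ c (collapse c (xs ++ ys)) (L._∨_ c (collapse c xs) (collapse c ys))
  collapse-∨ c = LL.⋁-map-++ c (λ u → Σ' (proj₂ u))

  collapse-meetRow : ∀ {c} (u : Elem QR c) ys →
                     L._≃_ c (collapse c (map (meetElem QR u) ys)) (L._∧_ c (Σ' (proj₂ u)) (collapse c ys))
  collapse-meetRow u [] = I.⊥-min _ , I.∧-lb₂ _
  collapse-meetRow u (v ∷ ys) =
    I.≃-trans _ (LL.∨-cong _ (Σ∧Σ⇐ , Σ∧Σ⇒) (collapse-meetRow u ys)) (I.≃-sym _ (LL.∧-distribˡ-∨ _))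

  collapse-∧ : ∀ c xs ys → L._≃_ c (collapse c (Q∃L._∧_ c xs ys)) (L._∧_ c (collapse c xs) (collapse c ys))
  collapse-∧ c [] ys = I.⊥-min _ , I.∧-lb₁ _
  collapse-∧ c (u ∷ xs) ys =
    I.≃-trans _ (collapse-∨ c (map (meetElem QR u) ys) (Q∃L._∧_ c xs ys))
   (I.≃-trans _ (LL.∨-cong _ (collapse-meetRow u ys) (collapse-∧ c xs ys)) (I.≃-sym _ (LL.∧-distribʳ-∨ _)))

  collapse-reindex : ∀ {c c'} (f : Hom c' c) ys →
                     L._≃_ c' (collapse c' (Q∃.reindex f ys))
                              (reindex f (collapse c ys))
  collapse-reindex f [] = I.⊥-min _ , proj₁ (RH.pres-⊥ _)
  collapse-reindex f (u ∷ ys) =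
    I.≃-trans _ (LL.∨-cong _ (I.≃-sym _ (beck-chevalley f (proj₂ u))) (collapse-reindex f ys))
                (I.≃-sym _ (RH.pres-∨ _ _ _))

  collapse-Σ : ∀ d c ys → L._≃_ c (collapse c (Q∃.exists d c ys)) (Σ' {d} (collapse (d × c) ys))
  collapse-Σ d c [] = I.⊥-min _ , Σ-⊥
  collapse-Σ d c (u ∷ ys) =
    I.≃-trans _ (LL.∨-cong _ (ΣΣ⇐ , ΣΣ⇒) (collapse-Σ d c ys))
                (I.∨-lub _ (Σ-mono (I.∨-ub₁ _)) (Σ-mono (I.∨-ub₂ _)) , Σ-∨)

  counit : ExMor (ExComp QR) (ExDoctrine.rawEx Q)
  counit = record
    { mor = record
      { F = idFP D
      ; α = collapse
      ; isMor = record
        { α-hom = λ c → record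
          { mono = collapse-mono
          ; pres-⊤ = collapse-⊤ c
          ; pres-⊥ = rfl , rfl
          ; pres-∧ = collapse-∧ c
          ; pres-∨ = collapse-∨ c }
        ; α-nat = collapse-reindex } }
    ; α-Σ = λ d c ys → I.≃-trans _ (collapse-Σ d c ys) (Σ-mono rid⇐ , Σ-mono rid⇒) }

module Unit {a : Level} {C : CartCat a} (P : Doctrine C) where
  open CartCat C
  open ProductLemmas C
  open CoverLemmas P

  ι : ∀ c → Car c → List (Elem PR c)
  ι c x = (𝟙 , reindex π₂ x) ∷ []

  ≼-id : ∀ {c} {x y : Car (𝟙 × c)} → L._≤_ _ x y → (𝟙 , x) ≼ (𝟙 , y)
  ≼-id p = ≼-by id identityʳ (p ⟫ rid⇐)

  ι-∧ : ∀ c x y → _∼_ {c} (𝟙 , reindex π₂ (L._∧_ c x y)) (meetElem PR (𝟙 , reindex π₂ x) (𝟙 , reindex π₂ y))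
  ι-∧ c x y =
    ≼-by diag project₂ (r∧⇒ π₂ ⟫ ∧m (rsplit π₂∘π₁×id∘diag ⟫ r∘⇒) (rsplit π₂∘π₂×id∘diag ⟫ r∘⇒) ⟫ r∧⇐ diag) ,
    ≼-by π₁×id project₂ (∧m (rfuse project₂) (rfuse project₂) ⟫ r∧⇐ π₂ ⟫ rsplit project₂)
    where
      diag : Hom (𝟙 × c) ((𝟙 × 𝟙) × c)
      diag = ⟨ ⟨ π₁ , π₁ ⟩ , π₂ ⟩
      π₂∘π₁×id∘diag : π₂ ∘ (π₁×id ∘ diag) ≈ π₂
      π₂∘π₁×id∘diag = project₂∘ ■ project₂
      π₂∘π₂×id∘diag : π₂ ∘ (π₂×id ∘ diag) ≈ π₂
      π₂∘π₂×id∘diag = project₂∘ ■ project₂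

  ι-∨ : ∀ c x y → _≤∃_ PR (ι c (L._∨_ c x y)) (ι c x ++ ι c y)
  ι-∨ c x y = ((inˡ ∷ inʳ ∷ []) ,
               proj₁ (RH.pres-∨ π₂ x y) ⟫ I.∨-lub _ (rid⇐ ⟫ I.∨-ub₁ _) (rid⇐ ⟫ I.∨-ub₁ _ ⟫ I.∨-ub₂ _)) ∷ []
    where
      inˡ inʳ : Witness PR c 𝟙 (ι c x ++ ι c y)
      inˡ = record { tgt = _ ; mem = here refl ; arr = id ; comm = identityʳ }
      inʳ = record { tgt = _ ; mem = there (here refl) ; arr = id ; comm = identityʳ }

  η∃ : DocMor PR (RawExDoctrine.rawDoc (ExComp PR))
  η∃ = record
    { F = idFP C
    ; α = ι
    ; isMor = record
      { α-hom = λ c → record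
        { mono = λ p → ≼-id (rmono π₂ p) ∷ []
        ; pres-⊤ = pointwise⇒≃∃ ((≼-id (I.⊤-max _) , ≼-id (r⊤ π₂)) ∷ [])
        ; pres-⊥ = (([] , proj₁ (RH.pres-⊥ π₂)) ∷ []) , []
        ; pres-∧ = λ x y → pointwise⇒≃∃ (ι-∧ c x y ∷ [])
        ; pres-∨ = λ x y → ι-∨ c x y , ≼-id (rmono π₂ (I.∨-ub₁ _)) ∷ ≼-id (rmono π₂ (I.∨-ub₂ _)) ∷ [] }
      ; α-nat = λ f x → pointwise⇒≃∃ ((≼-id (rswap (≈.sym project₂)) , ≼-id (rswap project₂)) ∷ []) } }

module _ {a : Level} {C D : CartCat a} (P : Doctrine C) (Q : ExDoctrine D) where
  private
    module C = CartCat C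
    PR : RawDoctrine C
    PR = Doctrine.raw P
  open CartCat D
  open ProductLemmas D
  open ExistsLemmas Q

  extend : DocMor PR (ExDoctrine.raw Q) → ExMor (ExComp PR) (ExDoctrine.rawEx Q)
  extend X = compEx Q (extMor X (LiftLaws.liftLaws P (ExDoctrine.doc Q) X)) (Counit.counit Q)

  restrict : ExMor (ExComp PR) (ExDoctrine.rawEx Q) → DocMor PR (ExDoctrine.raw Q)
  restrict β = compDoc (ExDoctrine.doc Q) (Unit.η∃ P) (ExMor.mor β)

  extendCell : ∀ {X Y} → Cell X Y → Cell (ExMor.mor (extend X)) (ExMor.mor (extend Y))
  extendCell {X} {Y} ω = record { ω = ω.ω ; isCell = record { nat = ω.nat ; le = le } }
    where
      module X = DocMor X
      module Y = DocMor Y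
      module ω = Cell ω
      module FX = FPFunctorLemmas X.F
      module FY = FPFunctorLemmas Y.F

      ω∘φ : ∀ {d c} → ω.ω (d C.× c) ∘ X.φ d c ≈ Y.φ d c ∘ ⟨ ω.ω d ∘ π₁ , ω.ω c ∘ π₂ ⟩
      ω∘φ = FY.F×-ext (≈.sym assoc ■ ∘-resp-≈ˡ (ω.nat C.π₁) ■ assoc ■ ∘-resp-≈ʳ FX.Fπ₁∘φ ■ ≈.sym (FY.Fπ₁∘φ∘ ■ project₁))
                      (≈.sym assoc ■ ∘-resp-≈ˡ (ω.nat C.π₂) ■ assoc ■ ∘-resp-≈ʳ FX.Fπ₂∘φ ■ ≈.sym (FY.Fπ₂∘φ∘ ■ project₂))

      le : ∀ c xs → L._≤_ _ (ExMor.α (extend X) c xs) (reindex (ω.ω c) (ExMor.α (extend Y) c xs))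
      le c [] = I.⊥-min _
      le c ((d , x) ∷ xs) =
        I.∨-lub _ (Σ-mono-reindex _ _ project₂ (rmono _ (ω.le _ x) ⟫ rswap ω∘φ) ⟫ rmono _ (I.∨-ub₁ _))
                  (le c xs ⟫ rmono _ (I.∨-ub₂ _))

  restrictCell : ∀ {β β'} → Cell (ExMor.mor β) (ExMor.mor β') → Cell (restrict β) (restrict β')
  restrictCell ω = record { ω = ω.ω ; isCell = record { nat = ω.nat ; le = λ c x → ω.le c (Unit.ι P c x) } }
    where module ω = Cell ω

  Φ : Functor (Doc P (ExDoctrine.doc Q)) (DocEx (ExComp PR) Q)
  Φ = record
    { F₀ = extend
    ; F₁ = extendCell
    ; identity = λ c → ≈.refl
    ; homomorphism = λ c → ≈.refl
    ; F-resp-≈ = λ p → p }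

  Ψ : Functor (DocEx (ExComp PR) Q) (Doc P (ExDoctrine.doc Q))
  Ψ = record
    { F₀ = restrict
    ; F₁ = λ {β} {β'} → restrictCell {β} {β'}
    ; identity = λ c → ≈.refl
    ; homomorphism = λ c → ≈.refl
    ; F-resp-≈ = λ p → p }

  restrict-extend : ∀ X → restrict (extend X) ≐ X
  restrict-extend X =
    (λ c → refl) ,
    record { nat = λ f → id-comm ; le = λ c x → ≤X c x ⟫ rid⇐ } ,
    record { nat = λ f → id-comm ; le = λ c x → X≤ c x ⟫ rid⇐ }
    where
      module X = DocMor X
      open MorphismLemmas P (ExDoctrine.doc Q) X
      open FPFunctorLemmas X.F

      ≤X : ∀ c x → L._≤_ _ (DocMor.α (restrict (extend X)) c x) (X.α c x)
      ≤X c x = I.∨-lub _ (Σ-lub (rmono _ (αn⇒ C.π₂) ⟫ rfuse Fπ₂∘φ)) (I.⊥-min _)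

      X≤ : ∀ c x → L._≤_ _ (X.α c x) (DocMor.α (restrict (extend X)) c x)
      X≤ c x = Σ-intro s project₂ (rid⇐ ⟫ rsplit (∘-resp-≈ˡ Fπ₂∘φ ■ project₂) ⟫ rmono s (r∘⇒ ⟫ rmono _ (αn⇐ C.π₂)))
               ⟫ I.∨-ub₁ _
        where
          s : Hom (X.F₀ c) (X.F₀ C.𝟙 × X.F₀ c)
          s = ⟨ X.𝟙-inv ∘ ! , id ⟩

  extend-restrict : ∀ β → ExMor.mor (extend (restrict β)) ≐ ExMor.mor β
  extend-restrict β =
    (λ c → refl) ,
    record { nat = λ f → id-comm ; le = λ c xs → proj₁ (agree c xs) ⟫ rid⇐ } ,
    record { nat = λ f → id-comm ; le = λ c xs → proj₂ (agree c xs) ⟫ rid⇐ }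
    where
      module β = ExMor β
      module βH (c : C.Obj) = IsLatHom (β.α-hom c)
      module CP = CoverLemmas P
      module CL = ProductLemmas C

      βc : ∀ {c} {xs ys : List (Elem PR c)} → _≤∃_ PR xs ys → _≤∃_ PR ys xs → L._≃_ _ (β.α c xs) (β.α c ys)
      βc p q = βH.mono _ p , βH.mono _ q

      -- {(d, x)} = Σ^∃_d ι(x), and β preserves Σ.
      single : ∀ {c} (u : Elem PR c) → L._≃_ _ (Σ' (proj₂ (LiftLaws.liftElem P (ExDoctrine.doc Q) (restrict β) c u)))
                                            (β.α c (u ∷ []))
      single {c} (d , x) =
        I.≃-trans _ (Σ-mono (rresp Fid∘φ) , Σ-mono (rresp (≈.sym Fid∘φ)))
       (I.≃-trans _ (I.≃-sym _ (β.α-Σ d c (Unit.ι P _ x)))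
        (βc (CP.covered-by CL.π₂×id C.project₂ (here refl) (CP.rfuse C.project₂) ∷ [])
            (CP.covered-by CL.unit×id C.project₂ (here refl)
                             (CP.rid⇐ CP.⟫ CP.rsplit CL.π₂∘assocʳ∘unit×id CP.⟫ CP.rmono CL.unit×id CP.r∘⇒) ∷ [])))
        where
          Fid∘φ : β.F₁ C.id ∘ β.φ d c ≈ β.φ d c
          Fid∘φ = ∘-resp-≈ˡ β.identity ■ identityˡ

      agree : ∀ c xs → L._≃_ _ (ExMor.α (extend (restrict β)) c xs) (β.α c xs)
      agree c [] = I.≃-sym _ (βH.pres-⊥ c)
      agree c (u ∷ xs) = I.≃-trans _ (LL.∨-cong _ (single u) (agree c xs)) (I.≃-sym _ (βH.pres-∨ c (u ∷ []) xs))

module _ {a : Level} {C' C D D' : CartCat a} (P' : Doctrine C') (P : Doctrine C)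
         (Q : ExDoctrine D) (Q' : ExDoctrine D')
         (L : DocMor (Doctrine.raw P') (Doctrine.raw P))
         (M : ExMor (ExDoctrine.rawEx Q) (ExDoctrine.rawEx Q')) where
  private
    module C' = CartCat C'
    module C = CartCat C
    module D = CartCat D
    module LM = DocMor L
    module M = ExMor M
    module MH (c : D.Obj) = IsLatHom (M.α-hom c)
    module QE = ExistsLemmas Q
  open CartCat D'
  open ProductLemmas D'
  open ExistsLemmas Q'

  extend-natural : ∀ X →
    ExMor.mor (extend P' Q' (whisker {Q = ExDoctrine.doc Q} {ExDoctrine.doc Q'} L (ExMor.mor M) X))
      ≐ ExMor.mor (compEx Q' (compEx Q (extMor L (LiftLaws.liftLaws P' P L)) (extend P Q X)) M)
  extend-natural X =
    (λ c → refl) ,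
    record { nat = λ f → id-comm ; le = λ c xs → proj₁ (agree c xs) ⟫ rid⇐ } ,
    record { nat = λ f → id-comm ; le = λ c xs → proj₂ (agree c xs) ⟫ rid⇐ }
    where
      module X = DocMor X
      LHS RHS : ExMor (ExComp (Doctrine.raw P')) (ExDoctrine.rawEx Q')
      LHS = extend P' Q' (whisker {Q = ExDoctrine.doc Q} {ExDoctrine.doc Q'} L (ExMor.mor M) X)
      RHS = compEx Q' (compEx Q (extMor L (LiftLaws.liftLaws P' P L)) (extend P Q X)) M

      Mn⇒ : ∀ {c d} (f : D.Hom c d) {x} → L._≤_ _ (M.α c (QE.reindex f x)) (reindex (M.F₁ f) (M.α d x))
      Mn⇒ f {x} = proj₁ (M.α-nat f x)
      Mn⇐ : ∀ {c d} (f : D.Hom c d) {x} → L._≤_ _ (reindex (M.F₁ f) (M.α d x)) (M.α c (QE.reindex f x))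
      Mn⇐ f {x} = proj₂ (M.α-nat f x)

      module WXm = MorphismLemmas P' (ExDoctrine.doc Q') (whisker {Q = ExDoctrine.doc Q} {ExDoctrine.doc Q'} L (ExMor.mor M) X)
      module Xm = MorphismLemmas P (ExDoctrine.doc Q) X
      module Lm = MorphismLemmas P' P L

      -- M preserves Σ, and the comparison map of M ∘ X ∘ L is built from those of M, X and L.
      single : ∀ {c} d x → L._≃_ _ (Σ' (WXm.αφ d c x)) (M.α _ (QE.Σ' (Xm.αφ _ _ (Lm.αφ d c x))))
      single {c} d x =
        (Σ-mono (r∘⇒ ⟫ rmono (M.φ _ _) (rresp M.homomorphism ⟫ r∘⇒
                        ⟫ rmono (M.F₁ φX) (Mn⇐ FXφL ⟫ MH.mono _ (proj₂ (X.α-nat (LM.φ d c) _))) ⟫ Mn⇐ φX))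
         ⟫ proj₂ (M.α-Σ _ _ _)) ,
        (proj₁ (M.α-Σ _ _ _)
         ⟫ Σ-mono (rmono (M.φ _ _) (Mn⇒ φX ⟫ rmono (M.F₁ φX) (MH.mono _ (proj₁ (X.α-nat (LM.φ d c) _)) ⟫ Mn⇒ FXφL)
                    ⟫ r∘⇐ ⟫ rresp (≈.sym M.homomorphism)) ⟫ r∘⇐))
        where
          FXφL : D.Hom (X.F₀ (LM.F₀ d C.× LM.F₀ c)) (X.F₀ (LM.F₀ (d C'.× c)))
          FXφL = X.F₁ (LM.φ d c)
          φX : D.Hom (X.F₀ (LM.F₀ d) D.× X.F₀ (LM.F₀ c)) (X.F₀ (LM.F₀ d C.× LM.F₀ c))
          φX = X.φ (LM.F₀ d) (LM.F₀ c)

      agree : ∀ c xs → L._≃_ _ (ExMor.α LHS c xs) (ExMor.α RHS c xs)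
      agree c [] = I.⊥-min _ , proj₁ (MH.pres-⊥ _)
      agree c ((d , x) ∷ xs) =
        I.∨-lub _ (proj₁ (single d x) ⟫ MH.mono _ (QE.I.∨-ub₁ _)) (proj₁ (agree c xs) ⟫ MH.mono _ (QE.I.∨-ub₂ _)) ,
        (proj₁ (MH.pres-∨ _ _ _) ⟫ ∨m (proj₂ (single d x)) (proj₂ (agree c xs)))

corollary4p10 : ∀ {a : Level} →
  Σ[ Φ ∈ (∀ {C D : CartCat a} (P : Doctrine C) (Q : ExDoctrine D) →
           Functor (Doc P (ExDoctrine.doc Q)) (DocEx (ExComp (Doctrine.raw P)) Q)) ]
  Σ[ Ψ ∈ (∀ {C D : CartCat a} (P : Doctrine C) (Q : ExDoctrine D) →
           Functor (DocEx (ExComp (Doctrine.raw P)) Q) (Doc P (ExDoctrine.doc Q))) ]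
  ((∀ {C D : CartCat a} (P : Doctrine C) (Q : ExDoctrine D) →
      FunctorEqDoc P (ExDoctrine.doc Q) (Ψ P Q ∘F Φ P Q) idF
      ×ₜ FunctorEqEx (ExComp (Doctrine.raw P)) Q (Φ P Q ∘F Ψ P Q) idF)
  ×ₜ
   Σ[ ext ∈ (∀ {C' C : CartCat a} (P' : Doctrine C') (P : Doctrine C)
              (L : DocMor (Doctrine.raw P') (Doctrine.raw P)) → ExtLaws L) ]
    (∀ {C' C D D' : CartCat a} (P' : Doctrine C') (P : Doctrine C) (Q : ExDoctrine D) (Q' : ExDoctrine D')
       (L : DocMor (Doctrine.raw P') (Doctrine.raw P))
       (M : ExMor (ExDoctrine.rawEx Q) (ExDoctrine.rawEx Q')) →
       FunctorEqEx (ExComp (Doctrine.raw P')) Q'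
         (Φ P' Q' ∘F W {P' = P'} {P} {ExDoctrine.doc Q} {ExDoctrine.doc Q'} L (ExMor.mor M))
         (W∃ {Q = Q} {Q'} (extMor L (ext P' P L)) M ∘F Φ P Q)))
corollary4p10 =
  Φ , Ψ ,
  (λ {_} {D} P Q →
     record { eq₀ = restrict-extend P Q ; eq₁ = λ f c → id-comm-sym D } ,
     record { eq₀ = extend-restrict P Q ; eq₁ = λ f c → id-comm-sym D }) ,
  LiftLaws.liftLaws ,
  (λ {D' = D'} P' P Q Q' L M → record { eq₀ = extend-natural P' P Q Q' L M ; eq₁ = λ f c → id-comm-sym D' })
  where open ProductLemmas using (id-comm-sym)
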